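{- Let $m\ge 5$, $X=\mathbb{F}_{2^m}\setminus\{0,1\}$, and let $W_5$ be as in the context. Then every element $x\in X$ lies in exactly $r_5=\frac{(2^m-4)(2^m-8)(2^m-16)}{4!}$ blocks of $W_5$ (the repetition number of $(X,W_2,W_5)$), and $|W_5|=\frac{(2^m-2)(2^m-4)(2^m-8)(2^m-16)}{5!}$.
   Context: $\mathbb{F}_{2^m}$ is the finite field with $2^m$ elements, with zero $0$ and unity $1$; all sums are in $\mathbb{F}_{2^m}$. For each integer $k\ge 2$, $W_k=\{B\subset X : |B|=k,\ \sum_{i\in B} i=1,\ \text{and } \binom{B}{\ell}\cap W_\ell=\emptyset \text{ for all } 2\le \ell\le k-3\}$ (recursive definition; $\binom{B}{\ell}$ is the set of $\ell$-subsets of $B$). -}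

module Defs where

open import Data.Bool using (Bool; true; false; _∧_; _∨_; not; if_then_else_)
open import Data.Nat using (ℕ; zero; suc; _∸_; _≡ᵇ_; _≤ᵇ_)
open import Data.Fin using (Fin)
open import Data.Fin.Properties using (_≟_)
open import Data.Fin.Subset using (Subset; ∣_∣)
open import Data.List using (List; []; _∷_; [_]; _++_; map; foldr; length; filterᵇ; allFin; upTo)
open import Data.Bool.ListAction using (any)
open import Data.Vec using ([]; _∷_; lookup)
import Data.Vec as Vec
open import Data.Product using (∃)
open import Algebra.Core using (Op₁; Op₂)
open import Algebra.Structures using (IsCommutativeRing)
open import Relation.Binary.PropositionalEquality using (_≡_; _≢_)
open import Relation.Nullary using (does)

-- A field structure on the finite set Fin q (so a finite field with q elements,
-- up to relabelling of its elements).
record FieldOn (q : ℕ) : Set where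
  field
    _+_ _*_ : Op₂ (Fin q)
    -_ : Op₁ (Fin q)
    0# 1# : Fin q
    isCommutativeRing : IsCommutativeRing _≡_ _+_ _*_ -_ 0# 1#
    0≢1 : 0# ≢ 1#
    inverse : ∀ x → x ≢ 0# → ∃ λ y → (x * y) ≡ 1#

subsets : (n : ℕ) → List (Subset n)
subsets zero = [ [] ]
subsets (suc n) = map (false ∷_) (subsets n) ++ map (true ∷_) (subsets n)

_⊆ᵇ_ : ∀ {n} → Subset n → Subset n → Bool
[] ⊆ᵇ [] = true
(a ∷ p) ⊆ᵇ (b ∷ r) = (not a ∨ b) ∧ (p ⊆ᵇ r)

countᵇ : ∀ {A : Set} → (A → Bool) → List A → ℕ
countᵇ P xs = length (filterᵇ P xs)

module Blocks {q : ℕ} (F : FieldOn q) where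
  open FieldOn F

  eqᵇ : Fin q → Fin q → Bool
  eqᵇ x y = does (x ≟ y)

  inXᵇ : Fin q → Bool
  inXᵇ x = not (eqᵇ x 0#) ∧ not (eqᵇ x 1#)

  ⊆Xᵇ : Subset q → Bool
  ⊆Xᵇ B = foldr (λ i acc → (not (lookup B i) ∨ inXᵇ i) ∧ acc) true (allFin q)

  sumS : Subset q → Fin q
  sumS B = foldr (λ i acc → if lookup B i then i + acc else acc) 0# (allFin q)

  baseᵇ : ℕ → Subset q → Bool
  baseᵇ k B = ⊆Xᵇ B ∧ (∣ B ∣ ≡ᵇ k) ∧ eqᵇ (sumS B) 1#

  -- Wrec c k B decides B ∈ W_k, correctly for all k ≤ c (fuel c).
  -- B ∈ W_k iff base conditions and no ℓ-subset S of B (2 ≤ ℓ ≤ k-3) lies in W_ℓ.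
  Wrec : ℕ → ℕ → Subset q → Bool
  Wrec zero k B = baseᵇ k B
  Wrec (suc c) k B =
    baseᵇ k B ∧
    not (any (λ ℓ → (2 ≤ᵇ ℓ) ∧
                    any (λ S → (S ⊆ᵇ B) ∧ (∣ S ∣ ≡ᵇ ℓ) ∧ Wrec c ℓ S) (subsets q))
             (upTo (suc (k ∸ 3))))

  inWᵇ : ℕ → Subset q → Bool
  inWᵇ k B = Wrec k k B

  cardW : ℕ → ℕ
  cardW k = countᵇ (inWᵇ k) (subsets q)

  repW : ℕ → Fin q → ℕ
  repW k x = countᵇ (λ B → inWᵇ k B ∧ lookup B x) (subsets q)

module Submission where

-- Write q = 2^m and X = F ∖ {0, 1}.  Since F has characteristic 2, a set
-- {x, b, c, d, e} ⊆ X of five distinct points with sum 1 containing no block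
-- of W₂ (a pair in X with sum 1) is the same as a tuple with
-- b = c + d + e + x + 1 and (c, d, e, x, 1) linearly independent over 𝔽₂:
-- each nontrivial vanishing 𝔽₂-combination of c, d, e, x, 1 is exactly the
-- failure of one of the defining conditions.  An independent family of k
-- vectors extends in q - 2^k ways, so for x ∈ X there are
-- (q - 4)(q - 8)(q - 16) ordered blocks (x, b, c, d, e); dividing by 4! gives
-- the repetition number, and summing over the q - 2 points of X and dividing
-- by 5! gives |W₅|.

open import Defs
open import Data.Nat using (ℕ; _≤_; _^_; _*_; _∸_; _/_; _!)
open import Data.Bool using (true)
open import Data.Fin using (Fin)
open import Data.Product using (_×_)
open import Relation.Binary.PropositionalEquality using (_≡_)

open import Algebra.Bundles using (CommutativeRing)
open import Algebra.Structures using (IsCommutativeMonoid)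
import Algebra.Properties.CommutativeSemigroup as CommutativeSemigroupProperties
import Algebra.Properties.Ring as RingProperties
import Algebra.Solver.CommutativeMonoid as CommutativeMonoidSolver
open import Data.Bool.Base using (Bool; false; not; _∧_; _∨_; _xor_; if_then_else_; T)
open import Data.Bool.ListAction using (any)
open import Data.Bool.Properties
  using (∨-zeroʳ; ∨-identityʳ; ∧-zeroʳ; ∧-identityʳ; ∧-conicalˡ; ∧-conicalʳ; not-involutive; ∧-isCommutativeMonoid)
open import Data.Empty using (⊥; ⊥-elim)
open import Data.Fin.Base using (zero; suc; toℕ)
open import Data.Fin.Permutation using (permutation)
open import Data.Fin.Properties using (_≟_; toℕ-injective)
open import Data.Fin.Subset using (Subset; ∣_∣) renaming (⊥ to ∅)
open import Data.List.Base using ([]; _∷_; map; foldr; tabulate; allFin) renaming (_++_ to _++ₗ_)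
open import Data.List.Properties using (map-tabulate; foldr-map)
open import Data.Nat using (zero; suc; _+_; _≡ᵇ_; _<?_; NonZero; s≤s)
open import Data.Nat.DivMod using (m*n/n≡m)
import Data.Nat.Properties as ℕₚ
open import Data.Nat.Tactic.RingSolver using (solve-∀)
open import Data.Product.Base using (∃; _,_; proj₁; proj₂)
open import Data.Vec.Base using (Vec; []; _∷_; _++_; lookup; _[_]≔_; zipWith; replicate)
open import Data.Vec.Membership.Propositional using (_∈_)
open import Data.Vec.Properties using (lookup∘update; lookup∘update′)
open import Data.Vec.Relation.Unary.All using (All; []; _∷_)
import Data.Vec.Relation.Unary.All as All
open import Data.Vec.Relation.Unary.AllPairs using (AllPairs; []; _∷_)
open import Data.Vec.Relation.Unary.Any using (here; there)
open import Function.Base using (_∘_)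
open import Level using (0ℓ)
open import Relation.Binary.Definitions using (tri<; tri≈; tri>)
open import Relation.Binary.PropositionalEquality
  using (refl; sym; trans; cong; cong₂; subst; _≢_; module ≡-Reasoning)
open import Relation.Nullary using (does; yes; no)
open import Relation.Nullary.Decidable using (dec-true; dec-false)
open import Relation.Nullary.Negation using (contradiction)

open import Algebra.Properties.Semiring.Sum ℕₚ.+-*-semiring
  using (sum; sum-syntax; sum-cong-≗; sum-replicate-zero; ∑-distrib-+; ∑-comm;
         *-distribˡ-sum; *-distribʳ-sum; sum-permute)
open CommutativeSemigroupProperties ℕₚ.*-commutativeSemigroup using () renaming (x∙yz≈y∙xz to *-left-comm)

⟦_⟧ : Bool → ℕ
⟦ true ⟧ = 1
⟦ false ⟧ = 0

⟦∧⟧ : ∀ a b → ⟦ a ∧ b ⟧ ≡ ⟦ a ⟧ * ⟦ b ⟧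
⟦∧⟧ true b = sym (ℕₚ.*-identityˡ ⟦ b ⟧)
⟦∧⟧ false b = refl

⟦∨⟧-disjoint : ∀ a b → (a ≡ true → b ≡ true → ⊥) → ⟦ a ∨ b ⟧ ≡ ⟦ a ⟧ + ⟦ b ⟧
⟦∨⟧-disjoint true true disjoint = ⊥-elim (disjoint refl refl)
⟦∨⟧-disjoint true false _ = refl
⟦∨⟧-disjoint false b _ = refl

⟦not⟧ : ∀ b → ⟦ not b ⟧ + ⟦ b ⟧ ≡ 1
⟦not⟧ true = refl
⟦not⟧ false = refl

infix 7 _≟ᵇ_
_≟ᵇ_ : ∀ {n} → Fin n → Fin n → Bool
x ≟ᵇ y = does (x ≟ y)

≟ᵇ-sound : ∀ {n} {x y : Fin n} → x ≟ᵇ y ≡ true → x ≡ y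
≟ᵇ-sound {x = x} {y} x≟y with x ≟ y
... | yes x≡y = x≡y

∑-zero : ∀ n → ∑[ i < n ] 0 ≡ 0
∑-zero = sum-replicate-zero

∑-ones : ∀ n → ∑[ i < n ] 1 ≡ n
∑-ones zero = refl
∑-ones (suc n) = cong suc (∑-ones n)

∑-delta : ∀ n (a : Fin n) (f : Fin n → ℕ) → ∑[ y < n ] (⟦ y ≟ᵇ a ⟧ * f y) ≡ f a
∑-delta (suc n) zero f = begin
  f zero + 0 + ∑[ y < n ] (⟦ suc y ≟ᵇ zero ⟧ * f (suc y)) ≡⟨ cong (f zero + 0 +_) (∑-zero n) ⟩
  f zero + 0 + 0                                        ≡⟨ ℕₚ.+-identityʳ _ ⟩
  f zero + 0                                            ≡⟨ ℕₚ.+-identityʳ _ ⟩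
  f zero                                                ∎
  where open ≡-Reasoning
∑-delta (suc n) (suc a) f = ∑-delta n a (λ y → f (suc y))

∑-point : ∀ n (a : Fin n) → ∑[ y < n ] ⟦ y ≟ᵇ a ⟧ ≡ 1
∑-point n a = trans (sum-cong-≗ (λ y → sym (ℕₚ.*-identityʳ ⟦ y ≟ᵇ a ⟧))) (∑-delta n a (λ _ → 1))

∑-involution : ∀ n (σ : Fin n → Fin n) → (∀ x → σ (σ x) ≡ x) → (f : Fin n → ℕ) →
               ∑[ x < n ] f (σ x) ≡ ∑[ x < n ] f x
∑-involution n σ σσ f = sym (sum-permute f (permutation σ σ σσ σσ))

∑-complement : ∀ n (p : Fin n → Bool) → ∑[ x < n ] ⟦ not (p x) ⟧ ≡ n ∸ ∑[ x < n ] ⟦ p x ⟧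
∑-complement n p = begin
  ∑[ x < n ] ⟦ not (p x) ⟧                                     ≡⟨ ℕₚ.m+n∸n≡m _ (∑[ x < n ] ⟦ p x ⟧) ⟨
  ∑[ x < n ] ⟦ not (p x) ⟧ + ∑[ x < n ] ⟦ p x ⟧ ∸ ∑[ x < n ] ⟦ p x ⟧ ≡⟨ cong (_∸ ∑[ x < n ] ⟦ p x ⟧) (∑-distrib-+ {n} (λ x → ⟦ not (p x) ⟧) (λ x → ⟦ p x ⟧)) ⟨
  ∑[ x < n ] (⟦ not (p x) ⟧ + ⟦ p x ⟧) ∸ ∑[ x < n ] ⟦ p x ⟧         ≡⟨ cong (_∸ ∑[ x < n ] ⟦ p x ⟧) (trans (sum-cong-≗ (λ x → ⟦not⟧ (p x))) (∑-ones n)) ⟩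
  n ∸ ∑[ x < n ] ⟦ p x ⟧                                        ∎
  where open ≡-Reasoning

∑≡0⇒ : ∀ n (f : Fin n → ℕ) → ∑[ i < n ] f i ≡ 0 → ∀ i → f i ≡ 0
∑≡0⇒ (suc n) f s zero = ℕₚ.m+n≡0⇒m≡0 (f zero) s
∑≡0⇒ (suc n) f s (suc i) = ∑≡0⇒ n (λ i → f (suc i)) (ℕₚ.m+n≡0⇒n≡0 (f zero) s) i

∑≡0⇐ : ∀ n (f : Fin n → ℕ) → (∀ i → f i ≡ 0) → ∑[ i < n ] f i ≡ 0
∑≡0⇐ n f z = trans (sum-cong-≗ z) (∑-zero n)

∑ₛ : (n : ℕ) → (Subset n → ℕ) → ℕ
∑ₛ zero f = f []
∑ₛ (suc n) f = ∑ₛ n (λ B → f (false ∷ B)) + ∑ₛ n (λ B → f (true ∷ B))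

countᵇ-∷ : ∀ {A : Set} (P : A → Bool) x xs → countᵇ P (x ∷ xs) ≡ ⟦ P x ⟧ + countᵇ P xs
countᵇ-∷ P x xs with P x
... | true = refl
... | false = refl

countᵇ-++ : ∀ {A : Set} (P : A → Bool) xs ys → countᵇ P (xs ++ₗ ys) ≡ countᵇ P xs + countᵇ P ys
countᵇ-++ P [] ys = refl
countᵇ-++ P (x ∷ xs) ys = begin
  countᵇ P (x ∷ xs ++ₗ ys)              ≡⟨ countᵇ-∷ P x (xs ++ₗ ys) ⟩
  ⟦ P x ⟧ + countᵇ P (xs ++ₗ ys)          ≡⟨ cong (⟦ P x ⟧ +_) (countᵇ-++ P xs ys) ⟩
  ⟦ P x ⟧ + (countᵇ P xs + countᵇ P ys)   ≡⟨ ℕₚ.+-assoc ⟦ P x ⟧ _ _ ⟨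
  ⟦ P x ⟧ + countᵇ P xs + countᵇ P ys     ≡⟨ cong (_+ countᵇ P ys) (countᵇ-∷ P x xs) ⟨
  countᵇ P (x ∷ xs) + countᵇ P ys        ∎
  where open ≡-Reasoning

countᵇ-map : ∀ {A B : Set} (P : B → Bool) (g : A → B) xs → countᵇ P (map g xs) ≡ countᵇ (λ x → P (g x)) xs
countᵇ-map P g [] = refl
countᵇ-map P g (x ∷ xs) = begin
  countᵇ P (g x ∷ map g xs)                   ≡⟨ countᵇ-∷ P (g x) (map g xs) ⟩
  ⟦ P (g x) ⟧ + countᵇ P (map g xs)           ≡⟨ cong (⟦ P (g x) ⟧ +_) (countᵇ-map P g xs) ⟩
  ⟦ P (g x) ⟧ + countᵇ (λ x → P (g x)) xs     ≡⟨ countᵇ-∷ (λ x → P (g x)) x xs ⟨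
  countᵇ (λ x → P (g x)) (x ∷ xs)             ∎
  where open ≡-Reasoning

count-subsets : ∀ n (P : Subset n → Bool) → countᵇ P (subsets n) ≡ ∑ₛ n (λ B → ⟦ P B ⟧)
count-subsets zero P = trans (countᵇ-∷ P [] []) (ℕₚ.+-identityʳ _)
count-subsets (suc n) P = begin
  countᵇ P (map (false ∷_) (subsets n) ++ₗ map (true ∷_) (subsets n))
    ≡⟨ countᵇ-++ P (map (false ∷_) (subsets n)) _ ⟩
  countᵇ P (map (false ∷_) (subsets n)) + countᵇ P (map (true ∷_) (subsets n))
    ≡⟨ cong₂ _+_ (countᵇ-map P (false ∷_) (subsets n)) (countᵇ-map P (true ∷_) (subsets n)) ⟩
  countᵇ (λ B → P (false ∷ B)) (subsets n) + countᵇ (λ B → P (true ∷ B)) (subsets n)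
    ≡⟨ cong₂ _+_ (count-subsets n _) (count-subsets n _) ⟩
  ∑ₛ (suc n) (λ B → ⟦ P B ⟧)
    ∎
  where open ≡-Reasoning

any-false⇒ : ∀ {A : Set} (P : A → Bool) xs → any P xs ≡ false → countᵇ P xs ≡ 0
any-false⇒ P [] _ = refl
any-false⇒ P (x ∷ xs) none with P x
... | false = any-false⇒ P xs none

any-false⇐ : ∀ {A : Set} (P : A → Bool) xs → countᵇ P xs ≡ 0 → any P xs ≡ false
any-false⇐ P [] _ = refl
any-false⇐ P (x ∷ xs) zero-count with P x
... | false = any-false⇐ P xs zero-count

∑ₛ-cong : ∀ n {f g : Subset n → ℕ} → (∀ B → f B ≡ g B) → ∑ₛ n f ≡ ∑ₛ n g
∑ₛ-cong zero f≗g = f≗g []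
∑ₛ-cong (suc n) f≗g = cong₂ _+_ (∑ₛ-cong n (λ B → f≗g (false ∷ B))) (∑ₛ-cong n (λ B → f≗g (true ∷ B)))

∑ₛ-zero : ∀ n → ∑ₛ n (λ _ → 0) ≡ 0
∑ₛ-zero zero = refl
∑ₛ-zero (suc n) = cong₂ _+_ (∑ₛ-zero n) (∑ₛ-zero n)

∑ₛ-scale : ∀ n c (f : Subset n → ℕ) → c * ∑ₛ n f ≡ ∑ₛ n (λ B → c * f B)
∑ₛ-scale zero c f = refl
∑ₛ-scale (suc n) c f =
  trans (ℕₚ.*-distribˡ-+ c _ _) (cong₂ _+_ (∑ₛ-scale n c _) (∑ₛ-scale n c _))

∑ₛ-∑ : ∀ n m (g : Subset n → Fin m → ℕ) →
       ∑ₛ n (λ B → ∑[ i < m ] g B i) ≡ ∑[ i < m ] ∑ₛ n (λ B → g B i)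
∑ₛ-∑ zero m g = refl
∑ₛ-∑ (suc n) m g = trans (cong₂ _+_ (∑ₛ-∑ n m _) (∑ₛ-∑ n m _)) (sym (∑-distrib-+ {m} _ _))

∣∣-∑ : ∀ {n} (B : Subset n) → ∣ B ∣ ≡ ∑[ i < n ] ⟦ lookup B i ⟧
∣∣-∑ [] = refl
∣∣-∑ (true ∷ B) = cong suc (∣∣-∑ B)
∣∣-∑ (false ∷ B) = ∣∣-∑ B

∣∣-insert : ∀ {n} (B : Subset n) x → lookup B x ≡ false → ∣ B [ x ]≔ true ∣ ≡ suc ∣ B ∣
∣∣-insert (false ∷ B) zero _ = refl
∣∣-insert (true ∷ B) (suc x) x∉B = cong suc (∣∣-insert B x x∉B)
∣∣-insert (false ∷ B) (suc x) x∉B = ∣∣-insert B x x∉B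

double-count : ∀ n (h : Subset n → ℕ) →
               ∑ₛ n (λ B → ∣ B ∣ * h B) ≡ ∑[ x < n ] ∑ₛ n (λ B → ⟦ lookup B x ⟧ * h B)
double-count n h = begin
  ∑ₛ n (λ B → ∣ B ∣ * h B)                               ≡⟨ ∑ₛ-cong n (λ B → cong (_* h B) (∣∣-∑ B)) ⟩
  ∑ₛ n (λ B → (∑[ x < n ] ⟦ lookup B x ⟧) * h B)         ≡⟨ ∑ₛ-cong n (λ B → *-distribʳ-sum (h B) (λ x → ⟦ lookup B x ⟧)) ⟩
  ∑ₛ n (λ B → ∑[ x < n ] (⟦ lookup B x ⟧ * h B))         ≡⟨ ∑ₛ-∑ n n _ ⟩
  ∑[ x < n ] ∑ₛ n (λ B → ⟦ lookup B x ⟧ * h B)           ∎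
  where open ≡-Reasoning

-- The subsets containing x are exactly the sets B ∪ {x} with x ∉ B.
insertion : ∀ n (x : Fin n) (h : Subset n → ℕ) →
            ∑ₛ n (λ B → ⟦ lookup B x ⟧ * h B) ≡ ∑ₛ n (λ B → ⟦ not (lookup B x) ⟧ * h (B [ x ]≔ true))
insertion (suc n) zero h = begin
  ∑ₛ n (λ _ → 0) + ∑ₛ n (λ B → h (true ∷ B) + 0)     ≡⟨ cong (_+ ∑ₛ n (λ B → h (true ∷ B) + 0)) (∑ₛ-zero n) ⟩
  ∑ₛ n (λ B → h (true ∷ B) + 0)                      ≡⟨ ℕₚ.+-identityʳ _ ⟨
  ∑ₛ n (λ B → h (true ∷ B) + 0) + 0                  ≡⟨ cong (∑ₛ n (λ B → h (true ∷ B) + 0) +_) (∑ₛ-zero n) ⟨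
  ∑ₛ n (λ B → h (true ∷ B) + 0) + ∑ₛ n (λ _ → 0)     ∎
  where open ≡-Reasoning
insertion (suc n) (suc x) h =
  cong₂ _+_ (insertion n x (λ B → h (false ∷ B))) (insertion n x (λ B → h (true ∷ B)))

∑ₖ : (n k : ℕ) → (Subset n → ℕ) → ℕ
∑ₖ n k Q = ∑ₛ n (λ B → ⟦ ∣ B ∣ ≡ᵇ k ⟧ * Q B)

≡ᵇ-scale : ∀ a k → a * ⟦ a ≡ᵇ k ⟧ ≡ k * ⟦ a ≡ᵇ k ⟧
≡ᵇ-scale a k with a ≡ᵇ k in eq
... | true = cong (_* 1) (ℕₚ.≡ᵇ⇒≡ a k (subst T (sym eq) _))
... | false = trans (ℕₚ.*-zeroʳ a) (sym (ℕₚ.*-zeroʳ k))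

∑ₖ-containing : ∀ n k (x : Fin n) (Q : Subset n → ℕ) →
  ∑ₖ n (suc k) (λ B → ⟦ lookup B x ⟧ * Q B) ≡ ∑ₖ n k (λ B → ⟦ not (lookup B x) ⟧ * Q (B [ x ]≔ true))
∑ₖ-containing n k x Q = begin
  ∑ₛ n (λ B → ⟦ ∣ B ∣ ≡ᵇ suc k ⟧ * (⟦ lookup B x ⟧ * Q B))     ≡⟨ ∑ₛ-cong n (λ B → *-left-comm ⟦ ∣ B ∣ ≡ᵇ suc k ⟧ ⟦ lookup B x ⟧ (Q B)) ⟩
  ∑ₛ n (λ B → ⟦ lookup B x ⟧ * (⟦ ∣ B ∣ ≡ᵇ suc k ⟧ * Q B))     ≡⟨ insertion n x _ ⟩
  ∑ₛ n (λ B → ⟦ not (lookup B x) ⟧ * (⟦ ∣ B [ x ]≔ true ∣ ≡ᵇ suc k ⟧ * Q (B [ x ]≔ true)))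
                                                              ≡⟨ ∑ₛ-cong n (λ B → shrink B (lookup B x) refl) ⟩
  ∑ₖ n k (λ B → ⟦ not (lookup B x) ⟧ * Q (B [ x ]≔ true))     ∎
  where
  open ≡-Reasoning
  shrink : ∀ B b → lookup B x ≡ b →
           ⟦ not b ⟧ * (⟦ ∣ B [ x ]≔ true ∣ ≡ᵇ suc k ⟧ * Q (B [ x ]≔ true))
           ≡ ⟦ ∣ B ∣ ≡ᵇ k ⟧ * (⟦ not b ⟧ * Q (B [ x ]≔ true))
  shrink B true _ = sym (ℕₚ.*-zeroʳ ⟦ ∣ B ∣ ≡ᵇ k ⟧)
  shrink B false x∉B rewrite ∣∣-insert B x x∉B = *-left-comm 1 ⟦ ∣ B ∣ ≡ᵇ k ⟧ (Q (B [ x ]≔ true))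

-- Double counting the pairs (x, B) with x ∈ B: each (k+1)-subset arises
-- from k+1 pairs (k-subset B, new point x ∉ B).
insertion-step : ∀ n k (Q : Subset n → ℕ) →
  suc k * ∑ₖ n (suc k) Q ≡ ∑[ x < n ] ∑ₖ n k (λ B → ⟦ not (lookup B x) ⟧ * Q (B [ x ]≔ true))
insertion-step n k Q = begin
  suc k * ∑ₖ n (suc k) Q                                       ≡⟨ ∑ₛ-scale n (suc k) _ ⟩
  ∑ₛ n (λ B → suc k * (⟦ ∣ B ∣ ≡ᵇ suc k ⟧ * Q B))              ≡⟨ ∑ₛ-cong n size-weight ⟩
  ∑ₛ n (λ B → ∣ B ∣ * (⟦ ∣ B ∣ ≡ᵇ suc k ⟧ * Q B))              ≡⟨ double-count n _ ⟩
  ∑[ x < n ] ∑ₛ n (λ B → ⟦ lookup B x ⟧ * (⟦ ∣ B ∣ ≡ᵇ suc k ⟧ * Q B))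
                                                               ≡⟨ sum-cong-≗ (λ x → ∑ₛ-cong n (λ B → *-left-comm ⟦ lookup B x ⟧ ⟦ ∣ B ∣ ≡ᵇ suc k ⟧ (Q B))) ⟩
  ∑[ x < n ] ∑ₖ n (suc k) (λ B → ⟦ lookup B x ⟧ * Q B)          ≡⟨ sum-cong-≗ (λ x → ∑ₖ-containing n k x Q) ⟩
  ∑[ x < n ] ∑ₖ n k (λ B → ⟦ not (lookup B x) ⟧ * Q (B [ x ]≔ true)) ∎
  where
  open ≡-Reasoning
  size-weight : ∀ B → suc k * (⟦ ∣ B ∣ ≡ᵇ suc k ⟧ * Q B) ≡ ∣ B ∣ * (⟦ ∣ B ∣ ≡ᵇ suc k ⟧ * Q B)
  size-weight B = begin
    suc k * (⟦ ∣ B ∣ ≡ᵇ suc k ⟧ * Q B)   ≡⟨ ℕₚ.*-assoc (suc k) ⟦ ∣ B ∣ ≡ᵇ suc k ⟧ (Q B) ⟨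
    suc k * ⟦ ∣ B ∣ ≡ᵇ suc k ⟧ * Q B     ≡⟨ cong (_* Q B) (≡ᵇ-scale ∣ B ∣ (suc k)) ⟨
    ∣ B ∣ * ⟦ ∣ B ∣ ≡ᵇ suc k ⟧ * Q B     ≡⟨ ℕₚ.*-assoc ∣ B ∣ ⟦ ∣ B ∣ ≡ᵇ suc k ⟧ (Q B) ⟩
    ∣ B ∣ * (⟦ ∣ B ∣ ≡ᵇ suc k ⟧ * Q B)   ∎

∑ₖ-zero : ∀ n (Q : Subset n → ℕ) → ∑ₖ n 0 Q ≡ Q ∅
∑ₖ-zero zero Q = ℕₚ.+-identityʳ (Q [])
∑ₖ-zero (suc n) Q = begin
  ∑ₖ n 0 (λ B → Q (false ∷ B)) + ∑ₛ n (λ _ → 0)   ≡⟨ cong₂ _+_ (∑ₖ-zero n _) (∑ₛ-zero n) ⟩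
  Q ∅ + 0                                         ≡⟨ ℕₚ.+-identityʳ _ ⟩
  Q ∅                                             ∎
  where open ≡-Reasoning

-- Counting k-subsets through ordered k-tuples of distinct points

setOf : ∀ {n k} → Vec (Fin n) k → Subset n
setOf [] = ∅
setOf (a ∷ v) = setOf v [ a ]≔ true

distinctᵇ : ∀ {n k} → Vec (Fin n) k → Bool
distinctᵇ [] = true
distinctᵇ (a ∷ v) = not (lookup (setOf v) a) ∧ distinctᵇ v

∑ᵥ : (n k : ℕ) → (Vec (Fin n) k → ℕ) → ℕ
∑ᵥ n zero f = f []
∑ᵥ n (suc k) f = ∑[ a < n ] ∑ᵥ n k (λ v → f (a ∷ v))

∑ᵥ-cong : ∀ n k {f g : Vec (Fin n) k → ℕ} → (∀ v → f v ≡ g v) → ∑ᵥ n k f ≡ ∑ᵥ n k g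
∑ᵥ-cong n zero f≗g = f≗g []
∑ᵥ-cong n (suc k) f≗g = sum-cong-≗ (λ a → ∑ᵥ-cong n k (λ v → f≗g (a ∷ v)))

∑ᵥ-scale : ∀ n k c (f : Vec (Fin n) k → ℕ) → c * ∑ᵥ n k f ≡ ∑ᵥ n k (λ v → c * f v)
∑ᵥ-scale n zero c f = refl
∑ᵥ-scale n (suc k) c f =
  trans (*-distribˡ-sum c (λ a → ∑ᵥ n k (λ v → f (a ∷ v)))) (sum-cong-≗ {n} (λ a → ∑ᵥ-scale n k c _))

∑-∑ᵥ : ∀ n k (f : Fin n → Vec (Fin n) k → ℕ) →
       ∑[ a < n ] ∑ᵥ n k (f a) ≡ ∑ᵥ n k (λ v → ∑[ a < n ] f a v)
∑-∑ᵥ n zero f = refl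
∑-∑ᵥ n (suc k) f = begin
  ∑[ a < n ] ∑[ b < n ] ∑ᵥ n k (λ v → f a (b ∷ v))    ≡⟨ ∑-comm (λ a b → ∑ᵥ n k (λ v → f a (b ∷ v))) ⟩
  ∑[ b < n ] ∑[ a < n ] ∑ᵥ n k (λ v → f a (b ∷ v))    ≡⟨ sum-cong-≗ (λ b → ∑-∑ᵥ n k (λ a v → f a (b ∷ v))) ⟩
  ∑[ b < n ] ∑ᵥ n k (λ v → ∑[ a < n ] f a (b ∷ v))    ∎
  where open ≡-Reasoning

ordered-count : ∀ n k (Q : Subset n → ℕ) →
                k ! * ∑ₖ n k Q ≡ ∑ᵥ n k (λ v → ⟦ distinctᵇ v ⟧ * Q (setOf v))
ordered-count n zero Q = trans (ℕₚ.+-identityʳ _) (trans (∑ₖ-zero n Q) (sym (ℕₚ.+-identityʳ _)))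
ordered-count n (suc k) Q = begin
  suc k * k ! * ∑ₖ n (suc k) Q
    ≡⟨ cong (_* ∑ₖ n (suc k) Q) (ℕₚ.*-comm (suc k) (k !)) ⟩
  k ! * suc k * ∑ₖ n (suc k) Q
    ≡⟨ ℕₚ.*-assoc (k !) (suc k) _ ⟩
  k ! * (suc k * ∑ₖ n (suc k) Q)
    ≡⟨ cong (k ! *_) (insertion-step n k Q) ⟩
  k ! * ∑[ x < n ] ∑ₖ n k (Q′ x)
    ≡⟨ *-distribˡ-sum (k !) (λ x → ∑ₖ n k (Q′ x)) ⟩
  ∑[ x < n ] (k ! * ∑ₖ n k (Q′ x))
    ≡⟨ sum-cong-≗ (λ x → ordered-count n k (Q′ x)) ⟩
  ∑[ x < n ] ∑ᵥ n k (λ v → ⟦ distinctᵇ v ⟧ * Q′ x (setOf v))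
    ≡⟨ sum-cong-≗ (λ x → ∑ᵥ-cong n k (λ v → regroup x v)) ⟩
  ∑ᵥ n (suc k) (λ v → ⟦ distinctᵇ v ⟧ * Q (setOf v))
    ∎
  where
  open ≡-Reasoning
  Q′ : Fin n → Subset n → ℕ
  Q′ x B = ⟦ not (lookup B x) ⟧ * Q (B [ x ]≔ true)
  regroup : ∀ x v → ⟦ distinctᵇ v ⟧ * Q′ x (setOf v) ≡ ⟦ distinctᵇ (x ∷ v) ⟧ * Q (setOf (x ∷ v))
  regroup x v = begin
    ⟦ distinctᵇ v ⟧ * (⟦ not (lookup (setOf v) x) ⟧ * Q (setOf (x ∷ v)))
      ≡⟨ ℕₚ.*-assoc ⟦ distinctᵇ v ⟧ _ _ ⟨
    ⟦ distinctᵇ v ⟧ * ⟦ not (lookup (setOf v) x) ⟧ * Q (setOf (x ∷ v))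
      ≡⟨ cong (_* Q (setOf (x ∷ v))) (ℕₚ.*-comm ⟦ distinctᵇ v ⟧ _) ⟩
    ⟦ not (lookup (setOf v) x) ⟧ * ⟦ distinctᵇ v ⟧ * Q (setOf (x ∷ v))
      ≡⟨ cong (_* Q (setOf (x ∷ v))) (⟦∧⟧ (not (lookup (setOf v) x)) (distinctᵇ v)) ⟨
    ⟦ distinctᵇ (x ∷ v) ⟧ * Q (setOf (x ∷ v))
      ∎

-- `sumS`, `⊆Xᵇ` and `_⊆ᵇ_` of the definitions are all folds of a
-- commutative monoid over the points of a subset; on the set of entries of
-- a tuple of distinct points such a fold is a fold over the tuple.

module SubsetFold {A : Set} {_∙_ : A → A → A} {ε : A}
                  (isCM : IsCommutativeMonoid _≡_ _∙_ ε) where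
  open IsCommutativeMonoid isCM using (assoc; comm)

  infixl 6 _·_
  _·_ : A → A → A
  _·_ = _∙_

  ∏ : ∀ {n} → Subset n → (Fin n → A) → A
  ∏ [] w = ε
  ∏ (b ∷ B) w = if b then w zero · ∏ B (w ∘ suc) else ∏ B (w ∘ suc)

  ∏-foldr : ∀ {n} (B : Subset n) (w : Fin n → A) (c : Fin n → A → A) →
            (∀ i acc → c i acc ≡ (if lookup B i then w i · acc else acc)) →
            foldr c ε (allFin n) ≡ ∏ B w
  ∏-foldr [] w c c≗ = refl
  ∏-foldr {suc n} (b ∷ B) w c c≗ = begin
    c zero (foldr c ε (tabulate suc))              ≡⟨ cong (λ xs → c zero (foldr c ε xs)) (map-tabulate (λ i → i) suc) ⟨
    c zero (foldr c ε (map suc (allFin n)))        ≡⟨ cong (c zero) (foldr-map c suc ε (allFin n)) ⟩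
    c zero (foldr (c ∘ suc) ε (allFin n))          ≡⟨ cong (c zero) (∏-foldr B (w ∘ suc) (c ∘ suc) (c≗ ∘ suc)) ⟩
    c zero (∏ B (w ∘ suc))                         ≡⟨ c≗ zero _ ⟩
    ∏ (b ∷ B) w                                    ∎
    where open ≡-Reasoning

  ∏-∅ : ∀ n (w : Fin n → A) → ∏ (∅ {n}) w ≡ ε
  ∏-∅ zero w = refl
  ∏-∅ (suc n) w = ∏-∅ n (w ∘ suc)

  ∏-insert : ∀ {n} (B : Subset n) (w : Fin n → A) a → lookup B a ≡ false →
             ∏ (B [ a ]≔ true) w ≡ w a · ∏ B w
  ∏-insert (false ∷ B) w zero _ = refl
  ∏-insert (false ∷ B) w (suc a) a∉B = ∏-insert B (w ∘ suc) a a∉B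
  ∏-insert (true ∷ B) w (suc a) a∉B = begin
    w zero · ∏ (B [ a ]≔ true) (w ∘ suc)    ≡⟨ cong (w zero ·_) (∏-insert B (w ∘ suc) a a∉B) ⟩
    w zero · (w (suc a) · ∏ B (w ∘ suc))    ≡⟨ assoc (w zero) _ _ ⟨
    w zero · w (suc a) · ∏ B (w ∘ suc)      ≡⟨ cong (_· ∏ B (w ∘ suc)) (comm (w zero) _) ⟩
    w (suc a) · w zero · ∏ B (w ∘ suc)      ≡⟨ assoc (w (suc a)) _ _ ⟩
    w (suc a) · (w zero · ∏ B (w ∘ suc))    ∎
    where open ≡-Reasoning

  ∏ᵗ : ∀ {n k} → (Fin n → A) → Vec (Fin n) k → A
  ∏ᵗ w [] = ε
  ∏ᵗ w (a ∷ v) = w a · ∏ᵗ w v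

  ∏-setOf : ∀ {n k} (v : Vec (Fin n) k) (w : Fin n → A) → distinctᵇ v ≡ true → ∏ (setOf v) w ≡ ∏ᵗ w v
  ∏-setOf {n} [] w _ = ∏-∅ n w
  ∏-setOf (a ∷ v) w distinct with lookup (setOf v) a in a∉v
  ... | false = trans (∏-insert (setOf v) w a a∉v) (cong (w a ·_) (∏-setOf v w distinct))

lookup-insert : ∀ {n} (B : Subset n) a j → lookup (B [ a ]≔ true) j ≡ (j ≟ᵇ a ∨ lookup B j)
lookup-insert B a j with j ≟ a
... | yes refl = lookup∘update j B true
... | no j≢a = lookup∘update′ j≢a B true

lookup-∅ : ∀ {n} (j : Fin n) → lookup (∅ {n}) j ≡ false
lookup-∅ zero = refl
lookup-∅ (suc j) = lookup-∅ j

setOf⇒∈ : ∀ {n k} (v : Vec (Fin n) k) j → lookup (setOf v) j ≡ true → j ∈ v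
setOf⇒∈ [] j j∈ with () ← trans (sym (lookup-∅ j)) j∈
setOf⇒∈ (a ∷ v) j j∈ rewrite lookup-insert (setOf v) a j with j ≟ a
... | yes j≡a = here j≡a
... | no _ = there (setOf⇒∈ v j j∈)

∈⇒setOf : ∀ {n k} (v : Vec (Fin n) k) j → j ∈ v → lookup (setOf v) j ≡ true
∈⇒setOf (a ∷ v) j (here refl) rewrite lookup-insert (setOf v) j j | dec-true (j ≟ j) refl = refl
∈⇒setOf (a ∷ v) j (there j∈v) rewrite lookup-insert (setOf v) a j | ∈⇒setOf v j j∈v = ∨-zeroʳ (j ≟ᵇ a)

∉⇒setOf : ∀ {n k} (v : Vec (Fin n) k) j → All (j ≢_) v → lookup (setOf v) j ≡ false
∉⇒setOf [] j [] = lookup-∅ j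
∉⇒setOf (a ∷ v) j (j≢a ∷ j∉v)
  rewrite lookup-insert (setOf v) a j | dec-false (j ≟ a) j≢a = ∉⇒setOf v j j∉v

setOf⇒∉ : ∀ {n k} (v : Vec (Fin n) k) j → lookup (setOf v) j ≡ false → All (j ≢_) v
setOf⇒∉ [] j _ = []
setOf⇒∉ (a ∷ v) j j∉ rewrite lookup-insert (setOf v) a j with j ≟ a
... | no j≢a = j≢a ∷ setOf⇒∉ v j j∉

distinctᵇ-sound : ∀ {n k} (v : Vec (Fin n) k) → distinctᵇ v ≡ true → AllPairs _≢_ v
distinctᵇ-sound [] _ = []
distinctᵇ-sound (a ∷ v) distinct with lookup (setOf v) a in a∉v
... | false = setOf⇒∉ v a a∉v ∷ distinctᵇ-sound v distinct

distinctᵇ-complete : ∀ {n k} (v : Vec (Fin n) k) → AllPairs _≢_ v → distinctᵇ v ≡ true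
distinctᵇ-complete [] [] = refl
distinctᵇ-complete (a ∷ v) (a∉v ∷ distinct)
  rewrite ∉⇒setOf v a a∉v = distinctᵇ-complete v distinct

allPairs-∈ : ∀ {A : Set} {R : A → A → Set} {k} {v : Vec A k} → (∀ {a b} → R a b → R b a) →
             AllPairs R v → ∀ {a b} → a ∈ v → b ∈ v → a ≢ b → R a b
allPairs-∈ sym-R (_ ∷ _) (here refl) (here refl) a≢b = contradiction refl a≢b
allPairs-∈ sym-R (Ra ∷ _) (here refl) (there b∈v) _ = All.lookup Ra b∈v
allPairs-∈ sym-R (Rb ∷ _) (there a∈v) (here refl) _ = sym-R (All.lookup Rb a∈v)
allPairs-∈ sym-R (_ ∷ Rs) (there a∈v) (there b∈v) a≢b = allPairs-∈ sym-R Rs a∈v b∈v a≢b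

∈⇒allPairs : ∀ {A : Set} {R : A → A → Set} {k} {v : Vec A k} → AllPairs _≢_ v →
             (∀ {a b} → a ∈ v → b ∈ v → a ≢ b → R a b) → AllPairs R v
∈⇒allPairs [] _ = []
∈⇒allPairs {R = R} (a∉v ∷ distinct) R-∈ =
  related a∉v (λ b∈v → R-∈ (here refl) (there b∈v)) ∷ ∈⇒allPairs distinct (λ a∈ b∈ → R-∈ (there a∈) (there b∈))
  where
  related : ∀ {a k} {v : Vec _ k} → All (a ≢_) v → (∀ {b} → b ∈ v → a ≢ b → R a b) → All (R a) v
  related [] _ = []
  related (a≢b ∷ a∉v) R-a = R-a (here refl) a≢b ∷ related a∉v (λ b∈v → R-a (there b∈v))

-- Fields with 2^(m+1) elements have characteristic 2

<-exactly-one : ∀ a b → a ≢ b → ⟦ does (a <? b) ⟧ + ⟦ does (b <? a) ⟧ ≡ 1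
<-exactly-one a b a≢b with ℕₚ.<-cmp a b
... | tri< a<b _ b≮a rewrite dec-true (a <? b) a<b | dec-false (b <? a) b≮a = refl
... | tri≈ _ a≡b _ = contradiction a≡b a≢b
... | tri> a≮b _ b<a rewrite dec-false (a <? b) a≮b | dec-true (b <? a) b<a = refl

-- An involution moves an even number of points: the moved points come
-- in pairs {x, σ x}, and each pair has exactly one "smaller" member.
involution-moved-even : ∀ n (σ : Fin n → Fin n) → (∀ x → σ (σ x) ≡ x) →
  ∑[ x < n ] ⟦ not (σ x ≟ᵇ x) ⟧ ≡ 2 * ∑[ x < n ] ⟦ does (toℕ x <? toℕ (σ x)) ⟧
involution-moved-even n σ σσ = begin
  ∑[ x < n ] ⟦ not (σ x ≟ᵇ x) ⟧           ≡⟨ sum-cong-≗ pair ⟨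
  ∑[ x < n ] (smaller x + smaller (σ x))  ≡⟨ ∑-distrib-+ {n} smaller (λ x → smaller (σ x)) ⟩
  S + ∑[ x < n ] smaller (σ x)             ≡⟨ cong (S +_) (∑-involution n σ σσ smaller) ⟩
  S + S                                    ≡⟨ cong (S +_) (ℕₚ.+-identityʳ S) ⟨
  2 * S                                    ∎
  where
  open ≡-Reasoning
  smaller : Fin n → ℕ
  smaller x = ⟦ does (toℕ x <? toℕ (σ x)) ⟧
  S : ℕ
  S = ∑[ x < n ] smaller x
  pair : ∀ x → smaller x + smaller (σ x) ≡ ⟦ not (σ x ≟ᵇ x) ⟧
  pair x with σ x ≟ x
  ... | yes σx≡x = cong₂ _+_ (fixed x σx≡x) (fixed (σ x) (cong σ σx≡x))
    where
    fixed : ∀ y → σ y ≡ y → smaller y ≡ 0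
    fixed y σy≡y = cong ⟦_⟧ (dec-false (toℕ y <? toℕ (σ y)) (ℕₚ.<-irrefl (cong toℕ (sym σy≡y))))
  ... | no σx≢x rewrite σσ x = <-exactly-one (toℕ x) (toℕ (σ x)) (λ e → σx≢x (sym (toℕ-injective e)))

2^suc∸1-odd : ∀ m → 2 ^ suc m ∸ 1 ≡ suc (2 * (2 ^ m ∸ 1))
2^suc∸1-odd m with 2 ^ m | ℕₚ.m^n>0 2 m
... | suc r | _ = ℕₚ.+-suc r (r + 0)

commutativeRing : ∀ {q} → FieldOn q → CommutativeRing 0ℓ 0ℓ
commutativeRing F = record { isCommutativeRing = FieldOn.isCommutativeRing F }

module Characteristic2 {q : ℕ} (F : FieldOn q) where
  open FieldOn F renaming (_+_ to infixl 6 _⊞_; _*_ to infixl 7 _⊠_; -_ to infix 8 ⊟_)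
  open CommutativeRing (commutativeRing F)
    using (-‿inverseʳ; distribʳ; *-identityˡ; *-assoc; *-comm; zeroˡ; zeroʳ)
  open RingProperties (CommutativeRing.ring (commutativeRing F)) using (-‿involutive; -0#≈0#)

  double : ∀ x → x ⊞ x ≡ (1# ⊞ 1#) ⊠ x
  double x = sym (trans (distribʳ x 1# 1#) (cong₂ _⊞_ (*-identityˡ x) (*-identityˡ x)))

  self-negative⇒0 : 1# ⊞ 1# ≢ 0# → ∀ x → ⊟ x ≡ x → x ≡ 0#
  self-negative⇒0 2≢0 x ⊟x≡x = begin
    x                  ≡⟨ *-identityˡ x ⟨
    1# ⊠ x             ≡⟨ cong (_⊠ x) (trans (*-comm ½ two) 2½≡1) ⟨
    ½ ⊠ two ⊠ x          ≡⟨ *-assoc ½ two x ⟩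
    ½ ⊠ (two ⊠ x)        ≡⟨ cong (½ ⊠_) (double x) ⟨
    ½ ⊠ (x ⊞ x)        ≡⟨ cong (λ y → ½ ⊠ (x ⊞ y)) ⊟x≡x ⟨
    ½ ⊠ (x ⊞ ⊟ x)      ≡⟨ cong (½ ⊠_) (-‿inverseʳ x) ⟩
    ½ ⊠ 0#             ≡⟨ zeroʳ ½ ⟩
    0#                 ∎
    where
    open ≡-Reasoning
    two ½ : Fin q
    two = 1# ⊞ 1#
    ½ = proj₁ (inverse two 2≢0)
    2½≡1 : two ⊠ ½ ≡ 1#
    2½≡1 = proj₂ (inverse two 2≢0)

  -- A field with 2^(m+1) elements satisfies 1 + 1 = 0: otherwise negation
  -- would be an involution moving exactly the q - 1 nonzero elements.
  two≡0 : ∀ m → q ≡ 2 ^ suc m → 1# ⊞ 1# ≡ 0#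
  two≡0 m q≡2^m+1 with (1# ⊞ 1#) ≟ 0#
  ... | yes 2≡0 = 2≡0
  ... | no 2≢0 = ⊥-elim (ℕₚ.even≢odd half (2 ^ m ∸ 1) (trans (sym q∸1-even) q∸1-odd))
    where
    -- the nonzero elements smaller than their negative: half of them
    half : ℕ
    half = ∑[ x < q ] ⟦ does (toℕ x <? toℕ (⊟ x)) ⟧
    moved : ∀ x → (⊟ x ≟ᵇ x) ≡ (x ≟ᵇ 0#)
    moved x with ⊟ x ≟ x | x ≟ 0#
    ... | yes ⊟x≡x | no x≢0 = contradiction (self-negative⇒0 2≢0 x ⊟x≡x) x≢0
    ... | no ⊟x≢x | yes refl = contradiction -0#≈0# ⊟x≢x
    ... | yes _ | yes _ = refl
    ... | no _ | no _ = refl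
    q∸1-even : q ∸ 1 ≡ 2 * half
    q∸1-even = begin
      q ∸ 1                              ≡⟨ cong (q ∸_) (∑-point q 0#) ⟨
      q ∸ ∑[ x < q ] ⟦ x ≟ᵇ 0# ⟧          ≡⟨ ∑-complement q (_≟ᵇ 0#) ⟨
      ∑[ x < q ] ⟦ not (x ≟ᵇ 0#) ⟧        ≡⟨ sum-cong-≗ (λ x → cong (λ b → ⟦ not b ⟧) (moved x)) ⟨
      ∑[ x < q ] ⟦ not (⊟ x ≟ᵇ x) ⟧       ≡⟨ involution-moved-even q ⊟_ -‿involutive ⟩
      2 * half                           ∎
      where open ≡-Reasoning
    q∸1-odd : q ∸ 1 ≡ suc (2 * (2 ^ m ∸ 1))
    q∸1-odd = trans (cong (_∸ 1) q≡2^m+1) (2^suc∸1-odd m)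

  char2 : ∀ m → q ≡ 2 ^ suc m → ∀ x → x ⊞ x ≡ 0#
  char2 m q≡2^m+1 x = begin
    x ⊞ x              ≡⟨ double x ⟩
    (1# ⊞ 1#) ⊠ x      ≡⟨ cong (_⊠ x) (two≡0 m q≡2^m+1) ⟩
    0# ⊠ x             ≡⟨ zeroˡ x ⟩
    0#                 ∎
    where open ≡-Reasoning

-- 𝔽₂-linear algebra in a field of characteristic 2

module Span {q : ℕ} (F : FieldOn q) (char2 : ∀ x → FieldOn._+_ F x x ≡ FieldOn.0# F) where
  open FieldOn F using (0#) renaming (_+_ to infixl 6 _⊞_)
  open CommutativeRing (commutativeRing F)
    using (+-assoc; +-comm; +-identityˡ; +-identityʳ; +-commutativeSemigroup)
  open CommutativeSemigroupProperties +-commutativeSemigroup using (interchange; x∙yz≈y∙xz)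

  -- In characteristic 2 every element is its own additive inverse.
  solve-for : ∀ {a d b} → a ⊞ d ≡ b → d ≡ a ⊞ b
  solve-for {a} {d} {b} a⊞d≡b = begin
    d              ≡⟨ +-identityˡ d ⟨
    0# ⊞ d         ≡⟨ cong (_⊞ d) (char2 a) ⟨
    a ⊞ a ⊞ d      ≡⟨ +-assoc a a d ⟩
    a ⊞ (a ⊞ d)    ≡⟨ cong (a ⊞_) a⊞d≡b ⟩
    a ⊞ b          ∎
    where open ≡-Reasoning

  sum≡0⇒≡ : ∀ {a b} → a ⊞ b ≡ 0# → a ≡ b
  sum≡0⇒≡ {a} a⊞b≡0 = sym (trans (solve-for a⊞b≡0) (+-identityʳ a))

  ≡⇒sum≡0 : ∀ {a b} → a ≡ b → a ⊞ b ≡ 0#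
  ≡⇒sum≡0 {a} refl = char2 a

  combination : ∀ {k} → Vec Bool k → Vec (Fin q) k → Fin q
  combination [] [] = 0#
  combination (t ∷ γ) (g ∷ gs) = if t then g ⊞ combination γ gs else combination γ gs

  infixl 6 _⊻_
  _⊻_ : ∀ {k} → Vec Bool k → Vec Bool k → Vec Bool k
  _⊻_ = zipWith _xor_

  combination-⊻ : ∀ {k} (α β : Vec Bool k) gs →
                  combination (α ⊻ β) gs ≡ combination α gs ⊞ combination β gs
  combination-⊻ [] [] [] = sym (+-identityˡ 0#)
  combination-⊻ (true ∷ α) (true ∷ β) (g ∷ gs) = begin
    combination (α ⊻ β) gs                     ≡⟨ combination-⊻ α β gs ⟩
    a ⊞ b                                      ≡⟨ +-identityˡ (a ⊞ b) ⟨
    0# ⊞ (a ⊞ b)                               ≡⟨ cong (_⊞ (a ⊞ b)) (char2 g) ⟨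
    g ⊞ g ⊞ (a ⊞ b)                            ≡⟨ interchange g g a b ⟩
    g ⊞ a ⊞ (g ⊞ b)                            ∎
    where
    open ≡-Reasoning
    a b : Fin q
    a = combination α gs
    b = combination β gs
  combination-⊻ (true ∷ α) (false ∷ β) (g ∷ gs) =
    trans (cong (g ⊞_) (combination-⊻ α β gs)) (sym (+-assoc g _ _))
  combination-⊻ (false ∷ α) (true ∷ β) (g ∷ gs) =
    trans (cong (g ⊞_) (combination-⊻ α β gs)) (x∙yz≈y∙xz g _ _)
  combination-⊻ (false ∷ α) (false ∷ β) (g ∷ gs) = combination-⊻ α β gs

  inSpan : ∀ {k} → Fin q → Vec (Fin q) k → Bool
  inSpan d [] = d ≟ᵇ 0#
  inSpan d (g ∷ gs) = inSpan d gs ∨ inSpan (g ⊞ d) gs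

  inSpan⇒ : ∀ {k} d (gs : Vec (Fin q) k) → inSpan d gs ≡ true → ∃ λ γ → combination γ gs ≡ d
  inSpan⇒ d [] d≟0 with d ≟ 0#
  ... | yes d≡0 = [] , sym d≡0
  inSpan⇒ d (g ∷ gs) d∈ with inSpan d gs in d∈gs
  ... | true = let (γ , γ≡d) = inSpan⇒ d gs d∈gs in false ∷ γ , γ≡d
  ... | false = let (γ , γ≡g⊞d) = inSpan⇒ (g ⊞ d) gs d∈ in true ∷ γ , sym (solve-for (sym γ≡g⊞d))

  inSpan⇐ : ∀ {k} d (gs : Vec (Fin q) k) γ → combination γ gs ≡ d → inSpan d gs ≡ true
  inSpan⇐ d [] [] refl = dec-true (0# ≟ 0#) refl
  inSpan⇐ d (g ∷ gs) (false ∷ γ) γ≡d rewrite inSpan⇐ d gs γ γ≡d = refl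
  inSpan⇐ d (g ∷ gs) (true ∷ γ) γ≡d
    rewrite inSpan⇐ (g ⊞ d) gs γ (solve-for γ≡d) = ∨-zeroʳ (inSpan d gs)

  ⊻-represents : ∀ {k} (gs : Vec (Fin q) k) α β {u v} →
                 combination α gs ≡ u → combination β gs ≡ v → combination (α ⊻ β) gs ≡ u ⊞ v
  ⊻-represents gs α β α↦u β↦v = trans (combination-⊻ α β gs) (cong₂ _⊞_ α↦u β↦v)

  vanishing⇒≡ : ∀ {k} (gs : Vec (Fin q) k) α β {u v} →
                combination α gs ≡ u → combination β gs ≡ v → combination (α ⊻ β) gs ≡ 0# → u ≡ v
  vanishing⇒≡ gs α β α↦u β↦v α⊻β↦0 = sum≡0⇒≡ (trans (sym (⊻-represents gs α β α↦u β↦v)) α⊻β↦0)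

  ≡⇒vanishing : ∀ {k} (gs : Vec (Fin q) k) α β {u v} →
                combination α gs ≡ u → combination β gs ≡ v → u ≡ v → combination (α ⊻ β) gs ≡ 0#
  ≡⇒vanishing gs α β α↦u β↦v u≡v = trans (⊻-represents gs α β α↦u β↦v) (≡⇒sum≡0 u≡v)

  vanishing⇒sum : ∀ {k} (gs : Vec (Fin q) k) α β ρ {u v w} →
                  combination α gs ≡ u → combination β gs ≡ v → combination ρ gs ≡ w →
                  combination (α ⊻ β ⊻ ρ) gs ≡ 0# → u ⊞ v ≡ w
  vanishing⇒sum gs α β ρ α↦u β↦v = vanishing⇒≡ gs (α ⊻ β) ρ (⊻-represents gs α β α↦u β↦v)

  sum⇒vanishing : ∀ {k} (gs : Vec (Fin q) k) α β ρ {u v w} →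
                  combination α gs ≡ u → combination β gs ≡ v → combination ρ gs ≡ w →
                  u ⊞ v ≡ w → combination (α ⊻ β ⊻ ρ) gs ≡ 0#
  sum⇒vanishing gs α β ρ α↦u β↦v = ≡⇒vanishing gs (α ⊻ β) ρ (⊻-represents gs α β α↦u β↦v)

  Independent : ∀ {k} → Vec (Fin q) k → Set
  Independent {k} gs = ∀ γ → combination γ gs ≡ 0# → γ ≡ replicate k false

  independentᵇ : ∀ {k} → Vec (Fin q) k → Bool
  independentᵇ [] = true
  independentᵇ (g ∷ gs) = independentᵇ gs ∧ not (inSpan g gs)

  independent-tail : ∀ {k} g (gs : Vec (Fin q) k) → Independent (g ∷ gs) → Independent gs
  independent-tail g gs ind γ γ≡0 with ind (false ∷ γ) γ≡0
  ... | refl = refl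

  independent-head : ∀ {k} g (gs : Vec (Fin q) k) → Independent (g ∷ gs) → inSpan g gs ≡ false
  independent-head g gs ind with inSpan g gs in g∈gs
  ... | false = refl
  ... | true with inSpan⇒ g gs g∈gs
  ... | γ , γ≡g with ind (true ∷ γ) (trans (cong (g ⊞_) γ≡g) (char2 g))
  ... | ()

  independentᵇ-sound : ∀ {k} (gs : Vec (Fin q) k) → independentᵇ gs ≡ true → Independent gs
  independentᵇ-sound [] _ [] _ = refl
  independentᵇ-sound (g ∷ gs) ind γ γ≡0 with independentᵇ gs in ind-gs | inSpan g gs in g∈gs
  independentᵇ-sound (g ∷ gs) ind (false ∷ γ) γ≡0 | true | false =
    cong (false ∷_) (independentᵇ-sound gs ind-gs γ γ≡0)
  independentᵇ-sound (g ∷ gs) ind (true ∷ γ) γ≡0 | true | false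
    with () ← trans (sym (inSpan⇐ g gs γ (sym (sum≡0⇒≡ γ≡0)))) g∈gs

  independentᵇ-complete : ∀ {k} (gs : Vec (Fin q) k) → Independent gs → independentᵇ gs ≡ true
  independentᵇ-complete [] _ = refl
  independentᵇ-complete (g ∷ gs) ind
    rewrite independentᵇ-complete gs (independent-tail g gs ind) | independent-head g gs ind = refl

  -- The span of k independent vectors has 2^k elements: it is the disjoint
  -- union of ⟨gs⟩ and its translate g + ⟨gs⟩.
  span-size : ∀ {k} (gs : Vec (Fin q) k) → Independent gs → ∑[ d < q ] ⟦ inSpan d gs ⟧ ≡ 2 ^ k
  span-size [] _ = ∑-point q 0#
  span-size {suc k} (g ∷ gs) ind = begin
    ∑[ d < q ] ⟦ inSpan d gs ∨ inSpan (g ⊞ d) gs ⟧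
      ≡⟨ sum-cong-≗ (λ d → ⟦∨⟧-disjoint (inSpan d gs) (inSpan (g ⊞ d) gs) (disjoint d)) ⟩
    ∑[ d < q ] (⟦ inSpan d gs ⟧ + ⟦ inSpan (g ⊞ d) gs ⟧)
      ≡⟨ ∑-distrib-+ {q} (λ d → ⟦ inSpan d gs ⟧) (λ d → ⟦ inSpan (g ⊞ d) gs ⟧) ⟩
    ∑[ d < q ] ⟦ inSpan d gs ⟧ + ∑[ d < q ] ⟦ inSpan (g ⊞ d) gs ⟧
      ≡⟨ cong (∑[ d < q ] ⟦ inSpan d gs ⟧ +_) (∑-involution q (g ⊞_) translate-involutive (λ d → ⟦ inSpan d gs ⟧)) ⟩
    ∑[ d < q ] ⟦ inSpan d gs ⟧ + ∑[ d < q ] ⟦ inSpan d gs ⟧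
      ≡⟨ cong₂ _+_ size-gs (trans size-gs (sym (ℕₚ.+-identityʳ _))) ⟩
    2 ^ k + (2 ^ k + 0)
      ∎
    where
    open ≡-Reasoning
    size-gs : ∑[ d < q ] ⟦ inSpan d gs ⟧ ≡ 2 ^ k
    size-gs = span-size gs (independent-tail g gs ind)
    translate-involutive : ∀ d → g ⊞ (g ⊞ d) ≡ d
    translate-involutive d = sym (solve-for refl)
    difference : ∀ {d} α β → combination α gs ≡ d → combination β gs ≡ g ⊞ d → combination (α ⊻ β) gs ≡ g
    difference {d} α β α↦d β↦g⊞d = begin
      combination (α ⊻ β) gs   ≡⟨ ⊻-represents gs α β α↦d β↦g⊞d ⟩
      d ⊞ (g ⊞ d)              ≡⟨ x∙yz≈y∙xz d g d ⟩
      g ⊞ (d ⊞ d)              ≡⟨ cong (g ⊞_) (char2 d) ⟩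
      g ⊞ 0#                   ≡⟨ +-identityʳ g ⟩
      g                        ∎
    disjoint : ∀ d → inSpan d gs ≡ true → inSpan (g ⊞ d) gs ≡ true → ⊥
    disjoint d d∈ g⊞d∈ with inSpan⇒ d gs d∈ | inSpan⇒ (g ⊞ d) gs g⊞d∈
    ... | α , α↦d | β , β↦g⊞d
      with () ← trans (sym (inSpan⇐ g gs (α ⊻ β) (difference α β α↦d β↦g⊞d))) (independent-head g gs ind)

  extension-count : ∀ {k} (gs : Vec (Fin q) k) →
                    ∑[ g < q ] ⟦ independentᵇ (g ∷ gs) ⟧ ≡ (q ∸ 2 ^ k) * ⟦ independentᵇ gs ⟧
  extension-count {k} gs with independentᵇ gs in ind
  ... | false = trans (∑-zero q) (sym (ℕₚ.*-zeroʳ (q ∸ 2 ^ k)))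
  ... | true = begin
    ∑[ g < q ] ⟦ not (inSpan g gs) ⟧     ≡⟨ ∑-complement q (λ g → inSpan g gs) ⟩
    q ∸ ∑[ g < q ] ⟦ inSpan g gs ⟧       ≡⟨ cong (q ∸_) (span-size gs (independentᵇ-sound gs ind)) ⟩
    q ∸ 2 ^ k                          ≡⟨ ℕₚ.*-identityʳ (q ∸ 2 ^ k) ⟨
    (q ∸ 2 ^ k) * 1                    ∎
    where open ≡-Reasoning

  extensions : ℕ → ℕ → ℕ
  extensions k zero = 1
  extensions k (suc j) = (q ∸ 2 ^ (j + k)) * extensions k j

  extension-count-tuples : ∀ j {k} (gs : Vec (Fin q) k) →
    ∑ᵥ q j (λ v → ⟦ independentᵇ (v ++ gs) ⟧) ≡ extensions k j * ⟦ independentᵇ gs ⟧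
  extension-count-tuples zero gs = sym (ℕₚ.+-identityʳ _)
  extension-count-tuples (suc j) {k} gs = begin
    ∑[ a < q ] ∑ᵥ q j (λ v → ⟦ independentᵇ (a ∷ v ++ gs) ⟧)
      ≡⟨ ∑-∑ᵥ q j (λ a v → ⟦ independentᵇ (a ∷ v ++ gs) ⟧) ⟩
    ∑ᵥ q j (λ v → ∑[ a < q ] ⟦ independentᵇ (a ∷ v ++ gs) ⟧)
      ≡⟨ ∑ᵥ-cong q j (λ v → extension-count (v ++ gs)) ⟩
    ∑ᵥ q j (λ v → (q ∸ 2 ^ (j + k)) * ⟦ independentᵇ (v ++ gs) ⟧)
      ≡⟨ ∑ᵥ-scale q j (q ∸ 2 ^ (j + k)) _ ⟨
    (q ∸ 2 ^ (j + k)) * ∑ᵥ q j (λ v → ⟦ independentᵇ (v ++ gs) ⟧)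
      ≡⟨ cong ((q ∸ 2 ^ (j + k)) *_) (extension-count-tuples j gs) ⟩
    (q ∸ 2 ^ (j + k)) * (extensions k j * ⟦ independentᵇ gs ⟧)
      ≡⟨ ℕₚ.*-assoc (q ∸ 2 ^ (j + k)) _ _ ⟨
    extensions k (suc j) * ⟦ independentᵇ gs ⟧
      ∎
    where open ≡-Reasoning

module TupleBlocks {q : ℕ} (F : FieldOn q) where
  open FieldOn F using (0#; 1#) renaming (_+_ to infixl 6 _⊞_)
  open CommutativeRing (commutativeRing F) using (+-isCommutativeMonoid; +-comm; +-identityʳ)
  open Blocks F
  module Sum = SubsetFold +-isCommutativeMonoid
  module Conj = SubsetFold ∧-isCommutativeMonoid

  Σᵗ : ∀ {k} → Vec (Fin q) k → Fin q
  Σᵗ = Sum.∏ᵗ (λ i → i)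

  sumS-setOf : ∀ {k} (v : Vec (Fin q) k) → distinctᵇ v ≡ true → sumS (setOf v) ≡ Σᵗ v
  sumS-setOf v distinct =
    trans (Sum.∏-foldr (setOf v) (λ i → i) _ (λ _ _ → refl)) (Sum.∏-setOf v (λ i → i) distinct)

  implication-step : ∀ b p acc → ((not b ∨ p) ∧ acc) ≡ (if b then p ∧ acc else acc)
  implication-step true p acc = refl
  implication-step false p acc = refl

  ⊆Xᵇ-setOf : ∀ {k} (v : Vec (Fin q) k) → distinctᵇ v ≡ true → ⊆Xᵇ (setOf v) ≡ Conj.∏ᵗ inXᵇ v
  ⊆Xᵇ-setOf v distinct =
    trans (Conj.∏-foldr (setOf v) inXᵇ _ (λ i → implication-step (lookup (setOf v) i) (inXᵇ i)))
          (Conj.∏-setOf v inXᵇ distinct)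

  ⊆ᵇ-∏ : ∀ {n} (S B : Subset n) → S ⊆ᵇ B ≡ Conj.∏ S (lookup B)
  ⊆ᵇ-∏ [] [] = refl
  ⊆ᵇ-∏ (s ∷ S) (b ∷ B) rewrite ⊆ᵇ-∏ S B = implication-step s b _

  ⊆ᵇ-setOf : ∀ {k} (v : Vec (Fin q) k) B → distinctᵇ v ≡ true → setOf v ⊆ᵇ B ≡ Conj.∏ᵗ (lookup B) v
  ⊆ᵇ-setOf v B distinct = trans (⊆ᵇ-∏ (setOf v) B) (Conj.∏-setOf v (lookup B) distinct)

  Conj-sound : ∀ {k} (p : Fin q → Bool) (v : Vec (Fin q) k) → Conj.∏ᵗ p v ≡ true → All (λ a → p a ≡ true) v
  Conj-sound p [] _ = []
  Conj-sound p (a ∷ v) pv = ∧-conicalˡ _ _ pv ∷ Conj-sound p v (∧-conicalʳ _ _ pv)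

  Conj-complete : ∀ {k} (p : Fin q → Bool) (v : Vec (Fin q) k) → All (λ a → p a ≡ true) v → Conj.∏ᵗ p v ≡ true
  Conj-complete p [] [] = refl
  Conj-complete p (a ∷ v) (pa ∷ pv) rewrite pa = Conj-complete p v pv

  W₂-subset : Subset q → Subset q → Bool
  W₂-subset B S = (S ⊆ᵇ B) ∧ ((∣ S ∣ ≡ᵇ 2) ∧ inWᵇ 2 S)

  containsW₂ : Subset q → Bool
  containsW₂ B = any (W₂-subset B) (subsets q)

  -- W₅ consists of the 5-subsets satisfying the base conditions that
  -- contain no block of W₂ (the recursion only looks at ℓ = 2).
  inW₅-unfold : ∀ B → inWᵇ 5 B ≡ baseᵇ 5 B ∧ not (containsW₂ B ∨ false)
  inW₅-unfold B = refl

  NoW₂Pair : Subset q → Set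
  NoW₂Pair B = ∀ i j → i ≢ j → lookup B i ≡ true → lookup B j ≡ true →
               inXᵇ i ≡ true → inXᵇ j ≡ true → i ⊞ j ≢ 1#

  private
    W₂-in : Subset q → Subset q → Bool
    W₂-in B S = (S ⊆ᵇ B) ∧ (⊆Xᵇ S ∧ eqᵇ (sumS S) 1#)

    W₂-pairs : ∀ B → countᵇ (W₂-subset B) (subsets q) * 2
                     ≡ ∑[ i < q ] ∑[ j < q ] (⟦ distinctᵇ (i ∷ j ∷ []) ⟧ * ⟦ W₂-in B (setOf (i ∷ j ∷ [])) ⟧)
    W₂-pairs B = begin
      countᵇ (W₂-subset B) (subsets q) * 2    ≡⟨ ℕₚ.*-comm (countᵇ (W₂-subset B) (subsets q)) 2 ⟩
      2 * countᵇ (W₂-subset B) (subsets q)    ≡⟨ cong (2 *_) (count-subsets q (W₂-subset B)) ⟩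
      2 * ∑ₛ q (λ S → ⟦ W₂-subset B S ⟧)      ≡⟨ cong (2 *_) (∑ₛ-cong q (λ S → size-first (S ⊆ᵇ B) (∣ S ∣ ≡ᵇ 2) (⊆Xᵇ S) (eqᵇ (sumS S) 1#))) ⟩
      2 ! * ∑ₖ q 2 (λ S → ⟦ W₂-in B S ⟧)      ≡⟨ ordered-count q 2 (λ S → ⟦ W₂-in B S ⟧) ⟩
      ∑ᵥ q 2 (λ v → ⟦ distinctᵇ v ⟧ * ⟦ W₂-in B (setOf v) ⟧) ∎
      where
      open ≡-Reasoning
      size-first : ∀ a s c d → ⟦ a ∧ (s ∧ ((c ∧ (s ∧ d)) ∧ true)) ⟧ ≡ ⟦ s ⟧ * ⟦ a ∧ (c ∧ d) ⟧
      size-first false s c d = sym (ℕₚ.*-zeroʳ ⟦ s ⟧)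
      size-first true false c d = refl
      size-first true true false d = refl
      size-first true true true false = refl
      size-first true true true true = refl

    pair-term : ∀ B i j → i ≢ j →
      ⟦ distinctᵇ (i ∷ j ∷ []) ⟧ * ⟦ W₂-in B (setOf (i ∷ j ∷ [])) ⟧
      ≡ ⟦ (lookup B i ∧ (lookup B j ∧ true)) ∧ ((inXᵇ i ∧ (inXᵇ j ∧ true)) ∧ eqᵇ (i ⊞ (j ⊞ 0#)) 1#) ⟧
    pair-term B i j i≢j = evaluate (distinctᵇ-complete (i ∷ j ∷ []) ((i≢j ∷ []) ∷ [] ∷ []))
      where
      evaluate : distinctᵇ (i ∷ j ∷ []) ≡ true →
        ⟦ distinctᵇ (i ∷ j ∷ []) ⟧ * ⟦ W₂-in B (setOf (i ∷ j ∷ [])) ⟧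
        ≡ ⟦ (lookup B i ∧ (lookup B j ∧ true)) ∧ ((inXᵇ i ∧ (inXᵇ j ∧ true)) ∧ eqᵇ (i ⊞ (j ⊞ 0#)) 1#) ⟧
      evaluate distinct
        rewrite distinct | ⊆ᵇ-setOf (i ∷ j ∷ []) B distinct | ⊆Xᵇ-setOf (i ∷ j ∷ []) distinct
              | sumS-setOf (i ∷ j ∷ []) distinct = ℕₚ.+-identityʳ _

    pair-terms-vanish : ∀ B → containsW₂ B ≡ false → ∀ i j →
      ⟦ distinctᵇ (i ∷ j ∷ []) ⟧ * ⟦ W₂-in B (setOf (i ∷ j ∷ [])) ⟧ ≡ 0
    pair-terms-vanish B none i j = ∑≡0⇒ q _ (∑≡0⇒ q _ all-vanish i) j
      where
      all-vanish : ∑ᵥ q 2 (λ v → ⟦ distinctᵇ v ⟧ * ⟦ W₂-in B (setOf v) ⟧) ≡ 0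
      all-vanish = trans (sym (W₂-pairs B)) (cong (_* 2) (any-false⇒ (W₂-subset B) (subsets q) none))

  containsW₂-false⇒ : ∀ B → containsW₂ B ≡ false → NoW₂Pair B
  containsW₂-false⇒ B none i j i≢j Bi Bj Xi Xj i⊞j≡1
    with trans (sym (pair-term B i j i≢j)) (pair-terms-vanish B none i j)
  ... | vanishes rewrite Bi | Bj | Xi | Xj | dec-true (i ⊞ (j ⊞ 0#) ≟ 1#) (trans (cong (i ⊞_) (+-identityʳ j)) i⊞j≡1)
    with () ← vanishes

  containsW₂-false⇐ : ∀ B → NoW₂Pair B → containsW₂ B ≡ false
  containsW₂-false⇐ B no-pair = any-false⇐ (W₂-subset B) (subsets q)
    (ℕₚ.m*n≡0⇒m≡0 _ 2 (trans (W₂-pairs B) (∑≡0⇐ q _ (λ i → ∑≡0⇐ q _ (term-vanishes i)))))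
    where
    term-vanishes : ∀ i j → ⟦ distinctᵇ (i ∷ j ∷ []) ⟧ * ⟦ W₂-in B (setOf (i ∷ j ∷ [])) ⟧ ≡ 0
    term-vanishes i j with distinctᵇ (i ∷ j ∷ []) in distinct
    ... | false = refl
    ... | true with distinctᵇ-sound (i ∷ j ∷ []) distinct
    ... | (i≢j ∷ []) ∷ _ = begin
      ⟦ true ⟧ * ⟦ W₂-in B (setOf (i ∷ j ∷ [])) ⟧   ≡⟨ cong (λ b → ⟦ b ⟧ * ⟦ W₂-in B (setOf (i ∷ j ∷ [])) ⟧) distinct ⟨
      ⟦ distinctᵇ (i ∷ j ∷ []) ⟧ * ⟦ W₂-in B (setOf (i ∷ j ∷ [])) ⟧ ≡⟨ pair-term B i j i≢j ⟩
      ⟦ (lookup B i ∧ (lookup B j ∧ true)) ∧ ((inXᵇ i ∧ (inXᵇ j ∧ true)) ∧ eqᵇ (i ⊞ (j ⊞ 0#)) 1#) ⟧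
        ≡⟨ not-W₂ (lookup B i) (lookup B j) (inXᵇ i) (inXᵇ j) refl refl refl refl ⟩
      0 ∎
      where
      open ≡-Reasoning
      not-W₂ : ∀ bi bj xi xj → lookup B i ≡ bi → lookup B j ≡ bj → inXᵇ i ≡ xi → inXᵇ j ≡ xj →
               ⟦ (bi ∧ (bj ∧ true)) ∧ ((xi ∧ (xj ∧ true)) ∧ eqᵇ (i ⊞ (j ⊞ 0#)) 1#) ⟧ ≡ 0
      not-W₂ true true true true Bi Bj Xi Xj with i ⊞ (j ⊞ 0#) ≟ 1#
      ... | yes sum≡1 = ⊥-elim (no-pair i j i≢j Bi Bj Xi Xj (trans (sym (cong (i ⊞_) (+-identityʳ j))) sum≡1))
      ... | no _ = refl
      not-W₂ true true true false _ _ _ _ = refl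
      not-W₂ true true false xj _ _ _ _ = refl
      not-W₂ true false xi xj _ _ _ _ = refl
      not-W₂ false bj xi xj _ _ _ _ = refl

  InX : Fin q → Set
  InX y = y ≢ 0# × y ≢ 1#

  inXᵇ-sound : ∀ {y} → inXᵇ y ≡ true → InX y
  inXᵇ-sound {y} y∈X with y ≟ 0# | y ≟ 1#
  ... | no y≢0 | no y≢1 = y≢0 , y≢1

  inXᵇ-complete : ∀ {y} → InX y → inXᵇ y ≡ true
  inXᵇ-complete {y} (y≢0 , y≢1) rewrite dec-false (y ≟ 0#) y≢0 | dec-false (y ≟ 1#) y≢1 = refl

  record BlockConditions {k} (w : Vec (Fin q) k) : Set where
    field
      distinct : AllPairs _≢_ w
      inX : All InX w
      noW₂ : AllPairs (λ u v → u ⊞ v ≢ 1#) w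
      sum≡1 : Σᵗ w ≡ 1#

  blockᵇ : Subset q → Bool
  blockᵇ B = ⊆Xᵇ B ∧ (eqᵇ (sumS B) 1# ∧ not (containsW₂ B ∨ false))

  inW₅-size : ∀ B → ⟦ inWᵇ 5 B ⟧ ≡ ⟦ ∣ B ∣ ≡ᵇ 5 ⟧ * ⟦ blockᵇ B ⟧
  inW₅-size B = trans (cong ⟦_⟧ (inW₅-unfold B)) (size-first (⊆Xᵇ B) (∣ B ∣ ≡ᵇ 5) (eqᵇ (sumS B) 1#) (not (containsW₂ B ∨ false)))
    where
    size-first : ∀ a s c d → ⟦ (a ∧ (s ∧ c)) ∧ d ⟧ ≡ ⟦ s ⟧ * ⟦ a ∧ (c ∧ d) ⟧
    size-first false s c d = sym (ℕₚ.*-zeroʳ ⟦ s ⟧)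
    size-first true false c d = refl
    size-first true true c d = sym (ℕₚ.+-identityʳ _)

  private
    noW₂-symmetric : ∀ {u v} → u ⊞ v ≢ 1# → v ⊞ u ≢ 1#
    noW₂-symmetric {u} {v} u⊞v≢1 v⊞u≡1 = u⊞v≢1 (trans (+-comm u v) v⊞u≡1)

  blockᵇ-sound : ∀ {k} (w : Vec (Fin q) k) → (distinctᵇ w ∧ blockᵇ (setOf w)) ≡ true → BlockConditions w
  blockᵇ-sound w holds = record
    { distinct = distinctᵇ-sound w distinct
    ; inX = All.map inXᵇ-sound inXᵇ-all
    ; noW₂ = ∈⇒allPairs (distinctᵇ-sound w distinct) λ {a} {b} a∈w b∈w a≢b →
        containsW₂-false⇒ (setOf w) noW₂ a b a≢b (∈⇒setOf w a a∈w) (∈⇒setOf w b b∈w)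
                          (All.lookup inXᵇ-all a∈w) (All.lookup inXᵇ-all b∈w)
    ; sum≡1 = trans (sym (sumS-setOf w distinct)) (≟ᵇ-sound (∧-conicalˡ (eqᵇ (sumS B) 1#) _ sum-noW₂))
    }
    where
    B : Subset q
    B = setOf w
    distinct : distinctᵇ w ≡ true
    distinct = ∧-conicalˡ (distinctᵇ w) (blockᵇ B) holds
    block : blockᵇ B ≡ true
    block = ∧-conicalʳ (distinctᵇ w) (blockᵇ B) holds
    sum-noW₂ : (eqᵇ (sumS B) 1# ∧ not (containsW₂ B ∨ false)) ≡ true
    sum-noW₂ = ∧-conicalʳ (⊆Xᵇ B) (eqᵇ (sumS B) 1# ∧ not (containsW₂ B ∨ false)) block
    inXᵇ-all : All (λ a → inXᵇ a ≡ true) w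
    inXᵇ-all = Conj-sound inXᵇ w (trans (sym (⊆Xᵇ-setOf w distinct)) (∧-conicalˡ (⊆Xᵇ B) _ block))
    noW₂ : containsW₂ B ≡ false
    noW₂ = begin
      containsW₂ B                      ≡⟨ ∨-identityʳ (containsW₂ B) ⟨
      containsW₂ B ∨ false              ≡⟨ not-involutive _ ⟨
      not (not (containsW₂ B ∨ false))  ≡⟨ cong not (∧-conicalʳ (eqᵇ (sumS B) 1#) _ sum-noW₂) ⟩
      false                             ∎
      where open ≡-Reasoning

  blockᵇ-complete : ∀ {k} (w : Vec (Fin q) k) → BlockConditions w → (distinctᵇ w ∧ blockᵇ (setOf w)) ≡ true
  blockᵇ-complete w conditions =
    evaluate (distinctᵇ-complete w distinct) (containsW₂-false⇐ (setOf w) no-pair)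
    where
    open BlockConditions conditions
    no-pair : NoW₂Pair (setOf w)
    no-pair i j i≢j i∈ j∈ _ _ = allPairs-∈ noW₂-symmetric noW₂ (setOf⇒∈ w i i∈) (setOf⇒∈ w j j∈) i≢j
    evaluate : distinctᵇ w ≡ true → containsW₂ (setOf w) ≡ false → (distinctᵇ w ∧ blockᵇ (setOf w)) ≡ true
    evaluate distinct′ none
      rewrite distinct′ | ⊆Xᵇ-setOf w distinct′ | Conj-complete inXᵇ w (All.map inXᵇ-complete inX)
            | sumS-setOf w distinct′ | sum≡1 | dec-true (1# ≟ 1#) refl | none = refl

-- Ordered 5-blocks as extensions of independent families

module FiveBlocks {q : ℕ} (F : FieldOn q) (char2 : ∀ x → FieldOn._+_ F x x ≡ FieldOn.0# F) where
  open FieldOn F using (0#; 1#; 0≢1) renaming (_+_ to infixl 6 _⊞_)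
  open CommutativeRing (commutativeRing F) using (+-identityʳ; +-commutativeMonoid)
  open Span F char2
  open TupleBlocks F
  open CommutativeMonoidSolver +-commutativeMonoid using (solve; _⊜_; _⊕_; id)

  generators : (x c d e : Fin q) → Vec (Fin q) 5
  generators x c d e = c ∷ d ∷ e ∷ x ∷ 1# ∷ []

  𝟘 𝟙 eC eD eE eX e1 : Vec Bool 5
  𝟘  = false ∷ false ∷ false ∷ false ∷ false ∷ []
  𝟙  = true  ∷ true  ∷ true  ∷ true  ∷ true  ∷ []
  eC = true  ∷ false ∷ false ∷ false ∷ false ∷ []
  eD = false ∷ true  ∷ false ∷ false ∷ false ∷ []
  eE = false ∷ false ∷ true  ∷ false ∷ false ∷ []
  eX = false ∷ false ∷ false ∷ true  ∷ false ∷ []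
  e1 = false ∷ false ∷ false ∷ false ∷ true  ∷ []

  split-block : ∀ x b c d e → Σᵗ (x ∷ b ∷ c ∷ d ∷ e ∷ []) ≡ c ⊞ (d ⊞ (e ⊞ (x ⊞ 0#))) ⊞ b
  split-block = solve 5 (λ x b c d e → x ⊕ (b ⊕ (c ⊕ (d ⊕ (e ⊕ id)))) ⊜ (c ⊕ (d ⊕ (e ⊕ (x ⊕ id)))) ⊕ b) refl

  split-generators : ∀ x c d e → Σᵗ (generators x c d e) ≡ c ⊞ (d ⊞ (e ⊞ (x ⊞ 0#))) ⊞ 1#
  split-generators x c d e =
    solve 5 (λ x c d e o → c ⊕ (d ⊕ (e ⊕ (x ⊕ (o ⊕ id)))) ⊜ (c ⊕ (d ⊕ (e ⊕ (x ⊕ id)))) ⊕ o) refl x c d e 1#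

  sum≡1⇒ : ∀ x b c d e → Σᵗ (x ∷ b ∷ c ∷ d ∷ e ∷ []) ≡ 1# → b ≡ Σᵗ (generators x c d e)
  sum≡1⇒ x b c d e sum≡1 = begin
    b                    ≡⟨ solve-for (trans (sym (split-block x b c d e)) sum≡1) ⟩
    s ⊞ 1#               ≡⟨ split-generators x c d e ⟨
    Σᵗ (generators x c d e) ∎
    where
    open ≡-Reasoning
    s : Fin q
    s = c ⊞ (d ⊞ (e ⊞ (x ⊞ 0#)))

  ⇒sum≡1 : ∀ x b c d e → b ≡ Σᵗ (generators x c d e) → Σᵗ (x ∷ b ∷ c ∷ d ∷ e ∷ []) ≡ 1#
  ⇒sum≡1 x b c d e b≡Σ = begin
    Σᵗ (x ∷ b ∷ c ∷ d ∷ e ∷ []) ≡⟨ split-block x b c d e ⟩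
    s ⊞ b                      ≡⟨ cong (s ⊞_) (trans b≡Σ (split-generators x c d e)) ⟩
    s ⊞ (s ⊞ 1#)               ≡⟨ solve-for refl ⟨
    1#                         ∎
    where
    open ≡-Reasoning
    s : Fin q
    s = c ⊞ (d ⊞ (e ⊞ (x ⊞ 0#)))

  module _ {x b c d e : Fin q} where
    private
      gs : Vec (Fin q) 5
      gs = generators x c d e
      rC : combination eC gs ≡ c
      rC = +-identityʳ c
      rD : combination eD gs ≡ d
      rD = +-identityʳ d
      rE : combination eE gs ≡ e
      rE = +-identityʳ e
      rX : combination eX gs ≡ x
      rX = +-identityʳ x
      r1 : combination e1 gs ≡ 1#
      r1 = +-identityʳ 1#

    conditions⇒independent : BlockConditions (x ∷ b ∷ c ∷ d ∷ e ∷ []) → Independent gs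
    conditions⇒independent record
      { distinct = (x≢b ∷ x≢c ∷ x≢d ∷ x≢e ∷ []) ∷ (b≢c ∷ b≢d ∷ b≢e ∷ []) ∷ (c≢d ∷ c≢e ∷ []) ∷ (d≢e ∷ []) ∷ [] ∷ []
      ; inX = (x≢0 , x≢1) ∷ (b≢0 , b≢1) ∷ (c≢0 , c≢1) ∷ (d≢0 , d≢1) ∷ (e≢0 , e≢1) ∷ []
      ; noW₂ = (x+b≢1 ∷ x+c≢1 ∷ x+d≢1 ∷ x+e≢1 ∷ []) ∷ (b+c≢1 ∷ b+d≢1 ∷ b+e≢1 ∷ []) ∷ (c+d≢1 ∷ c+e≢1 ∷ []) ∷ (d+e≢1 ∷ []) ∷ [] ∷ []
      ; sum≡1 = sum≡1
      } = vanishing-trivial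
      where
      rB : combination 𝟙 gs ≡ b
      rB = sym (sum≡1⇒ x b c d e sum≡1)
      vanishing-trivial : ∀ γ → combination γ gs ≡ 0# → γ ≡ 𝟘
      vanishing-trivial (false ∷ false ∷ false ∷ false ∷ false ∷ []) h = refl
      vanishing-trivial (false ∷ false ∷ false ∷ false ∷ true ∷ []) h = ⊥-elim (0≢1 (sym (vanishing⇒≡ gs e1 𝟘 r1 refl h)))
      vanishing-trivial (false ∷ false ∷ false ∷ true ∷ false ∷ []) h = ⊥-elim (x≢0 (vanishing⇒≡ gs eX 𝟘 rX refl h))
      vanishing-trivial (false ∷ false ∷ false ∷ true ∷ true ∷ []) h = ⊥-elim (x≢1 (vanishing⇒≡ gs eX e1 rX r1 h))
      vanishing-trivial (false ∷ false ∷ true ∷ false ∷ false ∷ []) h = ⊥-elim (e≢0 (vanishing⇒≡ gs eE 𝟘 rE refl h))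
      vanishing-trivial (false ∷ false ∷ true ∷ false ∷ true ∷ []) h = ⊥-elim (e≢1 (vanishing⇒≡ gs eE e1 rE r1 h))
      vanishing-trivial (false ∷ false ∷ true ∷ true ∷ false ∷ []) h = ⊥-elim (x≢e (vanishing⇒≡ gs eX eE rX rE h))
      vanishing-trivial (false ∷ false ∷ true ∷ true ∷ true ∷ []) h = ⊥-elim (x+e≢1 (vanishing⇒sum gs eX eE e1 rX rE r1 h))
      vanishing-trivial (false ∷ true ∷ false ∷ false ∷ false ∷ []) h = ⊥-elim (d≢0 (vanishing⇒≡ gs eD 𝟘 rD refl h))
      vanishing-trivial (false ∷ true ∷ false ∷ false ∷ true ∷ []) h = ⊥-elim (d≢1 (vanishing⇒≡ gs eD e1 rD r1 h))
      vanishing-trivial (false ∷ true ∷ false ∷ true ∷ false ∷ []) h = ⊥-elim (x≢d (vanishing⇒≡ gs eX eD rX rD h))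
      vanishing-trivial (false ∷ true ∷ false ∷ true ∷ true ∷ []) h = ⊥-elim (x+d≢1 (vanishing⇒sum gs eX eD e1 rX rD r1 h))
      vanishing-trivial (false ∷ true ∷ true ∷ false ∷ false ∷ []) h = ⊥-elim (d≢e (vanishing⇒≡ gs eD eE rD rE h))
      vanishing-trivial (false ∷ true ∷ true ∷ false ∷ true ∷ []) h = ⊥-elim (d+e≢1 (vanishing⇒sum gs eD eE e1 rD rE r1 h))
      vanishing-trivial (false ∷ true ∷ true ∷ true ∷ false ∷ []) h = ⊥-elim (b+c≢1 (vanishing⇒sum gs 𝟙 eC e1 rB rC r1 h))
      vanishing-trivial (false ∷ true ∷ true ∷ true ∷ true ∷ []) h = ⊥-elim (b≢c (vanishing⇒≡ gs 𝟙 eC rB rC h))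
      vanishing-trivial (true ∷ false ∷ false ∷ false ∷ false ∷ []) h = ⊥-elim (c≢0 (vanishing⇒≡ gs eC 𝟘 rC refl h))
      vanishing-trivial (true ∷ false ∷ false ∷ false ∷ true ∷ []) h = ⊥-elim (c≢1 (vanishing⇒≡ gs eC e1 rC r1 h))
      vanishing-trivial (true ∷ false ∷ false ∷ true ∷ false ∷ []) h = ⊥-elim (x≢c (vanishing⇒≡ gs eX eC rX rC h))
      vanishing-trivial (true ∷ false ∷ false ∷ true ∷ true ∷ []) h = ⊥-elim (x+c≢1 (vanishing⇒sum gs eX eC e1 rX rC r1 h))
      vanishing-trivial (true ∷ false ∷ true ∷ false ∷ false ∷ []) h = ⊥-elim (c≢e (vanishing⇒≡ gs eC eE rC rE h))
      vanishing-trivial (true ∷ false ∷ true ∷ false ∷ true ∷ []) h = ⊥-elim (c+e≢1 (vanishing⇒sum gs eC eE e1 rC rE r1 h))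
      vanishing-trivial (true ∷ false ∷ true ∷ true ∷ false ∷ []) h = ⊥-elim (b+d≢1 (vanishing⇒sum gs 𝟙 eD e1 rB rD r1 h))
      vanishing-trivial (true ∷ false ∷ true ∷ true ∷ true ∷ []) h = ⊥-elim (b≢d (vanishing⇒≡ gs 𝟙 eD rB rD h))
      vanishing-trivial (true ∷ true ∷ false ∷ false ∷ false ∷ []) h = ⊥-elim (c≢d (vanishing⇒≡ gs eC eD rC rD h))
      vanishing-trivial (true ∷ true ∷ false ∷ false ∷ true ∷ []) h = ⊥-elim (c+d≢1 (vanishing⇒sum gs eC eD e1 rC rD r1 h))
      vanishing-trivial (true ∷ true ∷ false ∷ true ∷ false ∷ []) h = ⊥-elim (b+e≢1 (vanishing⇒sum gs 𝟙 eE e1 rB rE r1 h))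
      vanishing-trivial (true ∷ true ∷ false ∷ true ∷ true ∷ []) h = ⊥-elim (b≢e (vanishing⇒≡ gs 𝟙 eE rB rE h))
      vanishing-trivial (true ∷ true ∷ true ∷ false ∷ false ∷ []) h = ⊥-elim (x+b≢1 (vanishing⇒sum gs eX 𝟙 e1 rX rB r1 h))
      vanishing-trivial (true ∷ true ∷ true ∷ false ∷ true ∷ []) h = ⊥-elim (x≢b (vanishing⇒≡ gs eX 𝟙 rX rB h))
      vanishing-trivial (true ∷ true ∷ true ∷ true ∷ false ∷ []) h = ⊥-elim (b≢1 (vanishing⇒≡ gs 𝟙 e1 rB r1 h))
      vanishing-trivial (true ∷ true ∷ true ∷ true ∷ true ∷ []) h = ⊥-elim (b≢0 (vanishing⇒≡ gs 𝟙 𝟘 rB refl h))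

    independent⇒conditions : b ≡ Σᵗ gs → Independent gs → BlockConditions (x ∷ b ∷ c ∷ d ∷ e ∷ [])
    independent⇒conditions b≡Σ independent = record
      { distinct = (sep eX 𝟙 rX rB (λ ()) ∷ sep eX eC rX rC (λ ()) ∷ sep eX eD rX rD (λ ()) ∷ sep eX eE rX rE (λ ()) ∷ [])
                 ∷ (sep 𝟙 eC rB rC (λ ()) ∷ sep 𝟙 eD rB rD (λ ()) ∷ sep 𝟙 eE rB rE (λ ()) ∷ [])
                 ∷ (sep eC eD rC rD (λ ()) ∷ sep eC eE rC rE (λ ()) ∷ [])
                 ∷ (sep eD eE rD rE (λ ()) ∷ []) ∷ [] ∷ []
      ; inX = in-X eX rX (λ ()) (λ ()) ∷ in-X 𝟙 rB (λ ()) (λ ()) ∷ in-X eC rC (λ ()) (λ ())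
            ∷ in-X eD rD (λ ()) (λ ()) ∷ in-X eE rE (λ ()) (λ ()) ∷ []
      ; noW₂ = (unb eX 𝟙 rX rB (λ ()) ∷ unb eX eC rX rC (λ ()) ∷ unb eX eD rX rD (λ ()) ∷ unb eX eE rX rE (λ ()) ∷ [])
             ∷ (unb 𝟙 eC rB rC (λ ()) ∷ unb 𝟙 eD rB rD (λ ()) ∷ unb 𝟙 eE rB rE (λ ()) ∷ [])
             ∷ (unb eC eD rC rD (λ ()) ∷ unb eC eE rC rE (λ ()) ∷ [])
             ∷ (unb eD eE rD rE (λ ()) ∷ []) ∷ [] ∷ []
      ; sum≡1 = ⇒sum≡1 x b c d e b≡Σ
      }
      where
      rB : combination 𝟙 gs ≡ b
      rB = sym b≡Σ
      sep : ∀ α β {u v} → combination α gs ≡ u → combination β gs ≡ v → α ⊻ β ≢ 𝟘 → u ≢ v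
      sep α β α↦u β↦v α⊻β≢0 u≡v = α⊻β≢0 (independent (α ⊻ β) (≡⇒vanishing gs α β α↦u β↦v u≡v))
      unb : ∀ α β {u v} → combination α gs ≡ u → combination β gs ≡ v → α ⊻ β ⊻ e1 ≢ 𝟘 → u ⊞ v ≢ 1#
      unb α β α↦u β↦v nonzero u⊞v≡1 = nonzero (independent (α ⊻ β ⊻ e1) (sum⇒vanishing gs α β e1 α↦u β↦v r1 u⊞v≡1))
      in-X : ∀ α {u} → combination α gs ≡ u → α ⊻ 𝟘 ≢ 𝟘 → α ⊻ e1 ≢ 𝟘 → InX u
      in-X α α↦u α≢0 α≢e1 = sep α 𝟘 α↦u refl α≢0 , sep α e1 α↦u r1 α≢e1


  bool-ext : ∀ {a b : Bool} → (a ≡ true → b ≡ true) → (b ≡ true → a ≡ true) → a ≡ b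
  bool-ext {false} {false} _ _ = refl
  bool-ext {false} {true} _ b⇒a = b⇒a refl
  bool-ext {true} {false} a⇒b _ = sym (a⇒b refl)
  bool-ext {true} {true} _ _ = refl

  block-tuple : ∀ x b c d e →
    (distinctᵇ (x ∷ b ∷ c ∷ d ∷ e ∷ []) ∧ blockᵇ (setOf (x ∷ b ∷ c ∷ d ∷ e ∷ [])))
    ≡ (b ≟ᵇ Σᵗ (generators x c d e) ∧ independentᵇ (generators x c d e))
  block-tuple x b c d e = bool-ext to from
    where
    w gs : Vec (Fin q) 5
    w = x ∷ b ∷ c ∷ d ∷ e ∷ []
    gs = generators x c d e
    to : (distinctᵇ w ∧ blockᵇ (setOf w)) ≡ true → (b ≟ᵇ Σᵗ gs ∧ independentᵇ gs) ≡ true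
    to holds = evaluate (blockᵇ-sound w holds)
      where
      evaluate : BlockConditions w → (b ≟ᵇ Σᵗ gs ∧ independentᵇ gs) ≡ true
      evaluate conditions
        rewrite dec-true (b ≟ Σᵗ gs) (sum≡1⇒ x b c d e (BlockConditions.sum≡1 conditions))
              | independentᵇ-complete gs (conditions⇒independent conditions) = refl
    from : (b ≟ᵇ Σᵗ gs ∧ independentᵇ gs) ≡ true → (distinctᵇ w ∧ blockᵇ (setOf w)) ≡ true
    from holds = blockᵇ-complete w (independent⇒conditions
      (≟ᵇ-sound (∧-conicalˡ (b ≟ᵇ Σᵗ gs) _ holds))
      (independentᵇ-sound gs (∧-conicalʳ (b ≟ᵇ Σᵗ gs) _ holds)))

-- Counting the blocks of W₅

module BlockCount {q : ℕ} (F : FieldOn q) (char2 : ∀ x → FieldOn._+_ F x x ≡ FieldOn.0# F) where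
  open FieldOn F using (0#; 1#; 0≢1) renaming (_+_ to infixl 6 _⊞_)
  open Blocks F
  open Span F char2
  open TupleBlocks F
  open FiveBlocks F char2

  ordered-blocks : Fin q → ℕ
  ordered-blocks x = ∑ᵥ q 4 (λ v → ⟦ distinctᵇ (x ∷ v) ∧ blockᵇ (setOf (x ∷ v)) ⟧)

  -- Each block of W₅ containing x can be ordered in 4! ways with x first.
  repW-ordered : ∀ x → 4 ! * repW 5 x ≡ ordered-blocks x
  repW-ordered x = begin
    4 ! * repW 5 x
      ≡⟨ cong (4 ! *_) (count-subsets q (λ B → inWᵇ 5 B ∧ lookup B x)) ⟩
    4 ! * ∑ₛ q (λ B → ⟦ inWᵇ 5 B ∧ lookup B x ⟧)
      ≡⟨ cong (4 ! *_) (∑ₛ-cong q size-first) ⟩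
    4 ! * ∑ₖ q 5 (λ B → ⟦ lookup B x ⟧ * ⟦ blockᵇ B ⟧)
      ≡⟨ cong (4 ! *_) (∑ₖ-containing q 4 x (λ B → ⟦ blockᵇ B ⟧)) ⟩
    4 ! * ∑ₖ q 4 (λ B → ⟦ not (lookup B x) ⟧ * ⟦ blockᵇ (B [ x ]≔ true) ⟧)
      ≡⟨ ordered-count q 4 (λ B → ⟦ not (lookup B x) ⟧ * ⟦ blockᵇ (B [ x ]≔ true) ⟧) ⟩
    ∑ᵥ q 4 (λ v → ⟦ distinctᵇ v ⟧ * (⟦ not (lookup (setOf v) x) ⟧ * ⟦ blockᵇ (setOf (x ∷ v)) ⟧))
      ≡⟨ ∑ᵥ-cong q 4 (λ v → conjoin (distinctᵇ v) (not (lookup (setOf v) x)) (blockᵇ (setOf (x ∷ v)))) ⟩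
    ordered-blocks x
      ∎
    where
    open ≡-Reasoning
    size-first : ∀ B → ⟦ inWᵇ 5 B ∧ lookup B x ⟧ ≡ ⟦ ∣ B ∣ ≡ᵇ 5 ⟧ * (⟦ lookup B x ⟧ * ⟦ blockᵇ B ⟧)
    size-first B = begin
      ⟦ inWᵇ 5 B ∧ lookup B x ⟧                           ≡⟨ ⟦∧⟧ (inWᵇ 5 B) (lookup B x) ⟩
      ⟦ inWᵇ 5 B ⟧ * ⟦ lookup B x ⟧                       ≡⟨ cong (_* ⟦ lookup B x ⟧) (inW₅-size B) ⟩
      ⟦ ∣ B ∣ ≡ᵇ 5 ⟧ * ⟦ blockᵇ B ⟧ * ⟦ lookup B x ⟧       ≡⟨ ℕₚ.*-assoc ⟦ ∣ B ∣ ≡ᵇ 5 ⟧ _ _ ⟩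
      ⟦ ∣ B ∣ ≡ᵇ 5 ⟧ * (⟦ blockᵇ B ⟧ * ⟦ lookup B x ⟧)     ≡⟨ cong (⟦ ∣ B ∣ ≡ᵇ 5 ⟧ *_) (ℕₚ.*-comm ⟦ blockᵇ B ⟧ _) ⟩
      ⟦ ∣ B ∣ ≡ᵇ 5 ⟧ * (⟦ lookup B x ⟧ * ⟦ blockᵇ B ⟧)     ∎
    conjoin : ∀ d n r → ⟦ d ⟧ * (⟦ n ⟧ * ⟦ r ⟧) ≡ ⟦ (n ∧ d) ∧ r ⟧
    conjoin false n r = sym (cong ⟦_⟧ (cong (_∧ r) (∧-zeroʳ n)))
    conjoin true n r = trans (ℕₚ.+-identityʳ _) (sym (trans (⟦∧⟧ (n ∧ true) r) (cong (λ b → ⟦ b ⟧ * ⟦ r ⟧) (∧-identityʳ n))))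

  -- Each block of W₅ can be ordered in 5! ways.
  cardW-ordered : 5 ! * cardW 5 ≡ ∑[ x < q ] ordered-blocks x
  cardW-ordered = begin
    5 ! * cardW 5                                       ≡⟨ cong (5 ! *_) (count-subsets q (inWᵇ 5)) ⟩
    5 ! * ∑ₛ q (λ B → ⟦ inWᵇ 5 B ⟧)                     ≡⟨ cong (5 ! *_) (∑ₛ-cong q inW₅-size) ⟩
    5 ! * ∑ₖ q 5 (λ B → ⟦ blockᵇ B ⟧)                   ≡⟨ ordered-count q 5 (λ B → ⟦ blockᵇ B ⟧) ⟩
    ∑ᵥ q 5 (λ v → ⟦ distinctᵇ v ⟧ * ⟦ blockᵇ (setOf v) ⟧) ≡⟨ sum-cong-≗ (λ x → ∑ᵥ-cong q 4 (λ v → sym (⟦∧⟧ (distinctᵇ (x ∷ v)) (blockᵇ (setOf (x ∷ v)))))) ⟩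
    ∑[ x < q ] ordered-blocks x                         ∎
    where open ≡-Reasoning

  -- An ordered block starting at x is a choice of c, d, e extending the
  -- independent family (x, 1), after which b is determined.
  ordered-blocks-count : ∀ x → ordered-blocks x ≡ extensions 2 3 * ⟦ independentᵇ (x ∷ 1# ∷ []) ⟧
  ordered-blocks-count x = begin
    ∑[ b < q ] ∑ᵥ q 3 (λ v → ⟦ distinctᵇ (x ∷ b ∷ v) ∧ blockᵇ (setOf (x ∷ b ∷ v)) ⟧)
      ≡⟨ sum-cong-≗ (λ b → ∑ᵥ-cong q 3 (characterise b)) ⟩
    ∑[ b < q ] ∑ᵥ q 3 (λ v → ⟦ b ≟ᵇ Σᵗ (v ++ x ∷ 1# ∷ []) ⟧ * ⟦ independentᵇ (v ++ x ∷ 1# ∷ []) ⟧)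
      ≡⟨ ∑-∑ᵥ q 3 (λ b v → ⟦ b ≟ᵇ Σᵗ (v ++ x ∷ 1# ∷ []) ⟧ * ⟦ independentᵇ (v ++ x ∷ 1# ∷ []) ⟧) ⟩
    ∑ᵥ q 3 (λ v → ∑[ b < q ] (⟦ b ≟ᵇ Σᵗ (v ++ x ∷ 1# ∷ []) ⟧ * ⟦ independentᵇ (v ++ x ∷ 1# ∷ []) ⟧))
      ≡⟨ ∑ᵥ-cong q 3 (λ v → ∑-delta q (Σᵗ (v ++ x ∷ 1# ∷ [])) (λ _ → ⟦ independentᵇ (v ++ x ∷ 1# ∷ []) ⟧)) ⟩
    ∑ᵥ q 3 (λ v → ⟦ independentᵇ (v ++ x ∷ 1# ∷ []) ⟧)
      ≡⟨ extension-count-tuples 3 (x ∷ 1# ∷ []) ⟩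
    extensions 2 3 * ⟦ independentᵇ (x ∷ 1# ∷ []) ⟧
      ∎
    where
    open ≡-Reasoning
    characterise : ∀ b (v : Vec (Fin q) 3) →
      ⟦ distinctᵇ (x ∷ b ∷ v) ∧ blockᵇ (setOf (x ∷ b ∷ v)) ⟧
      ≡ ⟦ b ≟ᵇ Σᵗ (v ++ x ∷ 1# ∷ []) ⟧ * ⟦ independentᵇ (v ++ x ∷ 1# ∷ []) ⟧
    characterise b (c ∷ d ∷ e ∷ []) =
      trans (cong ⟦_⟧ (block-tuple x b c d e)) (⟦∧⟧ (b ≟ᵇ Σᵗ (generators x c d e)) (independentᵇ (generators x c d e)))

  independent-1 : independentᵇ (1# ∷ []) ≡ true
  independent-1 = cong not (dec-false (1# ≟ 0#) (λ 1≡0 → 0≢1 (sym 1≡0)))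

  independent-x1 : ∀ {x} → inXᵇ x ≡ true → independentᵇ (x ∷ 1# ∷ []) ≡ true
  independent-x1 {x} x∈X with inXᵇ-sound x∈X
  ... | x≢0 , x≢1
    rewrite independent-1 | dec-false (x ≟ 0#) x≢0
          | dec-false (1# ⊞ x ≟ 0#) (λ 1+x≡0 → x≢1 (sym (sum≡0⇒≡ 1+x≡0))) = refl

  rep-product : ∀ a b c → c * (b * (a * 1)) * 1 ≡ a * b * c
  rep-product = solve-∀

  card-product : ∀ a b c d → c * (b * (a * 1)) * (d * 1) ≡ d * a * b * c
  card-product = solve-∀

  repW₅ : ∀ x → inXᵇ x ≡ true → repW 5 x * 4 ! ≡ (q ∸ 4) * (q ∸ 8) * (q ∸ 16)
  repW₅ x x∈X = begin
    repW 5 x * 4 !                                       ≡⟨ ℕₚ.*-comm (repW 5 x) (4 !) ⟩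
    4 ! * repW 5 x                                       ≡⟨ repW-ordered x ⟩
    ordered-blocks x                                     ≡⟨ ordered-blocks-count x ⟩
    extensions 2 3 * ⟦ independentᵇ (x ∷ 1# ∷ []) ⟧      ≡⟨ cong (λ b → extensions 2 3 * ⟦ b ⟧) (independent-x1 x∈X) ⟩
    extensions 2 3 * 1                                   ≡⟨ rep-product (q ∸ 4) (q ∸ 8) (q ∸ 16) ⟩
    (q ∸ 4) * (q ∸ 8) * (q ∸ 16)                         ∎
    where open ≡-Reasoning

  cardW₅ : cardW 5 * 5 ! ≡ (q ∸ 2) * (q ∸ 4) * (q ∸ 8) * (q ∸ 16)
  cardW₅ = begin
    cardW 5 * 5 !                                                ≡⟨ ℕₚ.*-comm (cardW 5) (5 !) ⟩
    5 ! * cardW 5                                                ≡⟨ cardW-ordered ⟩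
    ∑[ x < q ] ordered-blocks x                                  ≡⟨ sum-cong-≗ ordered-blocks-count ⟩
    ∑[ x < q ] (extensions 2 3 * ⟦ independentᵇ (x ∷ 1# ∷ []) ⟧)  ≡⟨ *-distribˡ-sum (extensions 2 3) (λ x → ⟦ independentᵇ (x ∷ 1# ∷ []) ⟧) ⟨
    extensions 2 3 * ∑[ x < q ] ⟦ independentᵇ (x ∷ 1# ∷ []) ⟧   ≡⟨ cong (extensions 2 3 *_) (extension-count (1# ∷ [])) ⟩
    extensions 2 3 * ((q ∸ 2) * ⟦ independentᵇ (1# ∷ []) ⟧)      ≡⟨ cong (λ b → extensions 2 3 * ((q ∸ 2) * ⟦ b ⟧)) independent-1 ⟩
    extensions 2 3 * ((q ∸ 2) * 1)                               ≡⟨ card-product (q ∸ 4) (q ∸ 8) (q ∸ 16) (q ∸ 2) ⟩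
    (q ∸ 2) * (q ∸ 4) * (q ∸ 8) * (q ∸ 16)                       ∎
    where open ≡-Reasoning

corollary3p16 : (m : ℕ) → 5 ≤ m → (F : FieldOn (2 ^ m)) →
  ((x : Fin (2 ^ m)) → Blocks.inXᵇ F x ≡ true →
    Blocks.repW F 5 x ≡ ((2 ^ m ∸ 4) * (2 ^ m ∸ 8) * (2 ^ m ∸ 16)) / (4 !))
  × (Blocks.cardW F 5 ≡ ((2 ^ m ∸ 2) * (2 ^ m ∸ 4) * (2 ^ m ∸ 8) * (2 ^ m ∸ 16)) / (5 !))
corollary3p16 (suc m) (s≤s _) F =
    (λ x x∈X → divide (repW₅ x x∈X))
  , divide cardW₅
  where
  open BlockCount F (Characteristic2.char2 F m refl)
  divide : ∀ {a n b} .{{_ : NonZero n}} → a * n ≡ b → a ≡ b / n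
  divide {a} {n} a*n≡b = trans (sym (m*n/n≡m a n)) (cong (_/ n) a*n≡b)
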